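{- Let $1\le a\le b$. For any toggle-symmetric probability distribution $\mu$ on $J(\mathscr T(a,b))$, $$\mathbb E[\mu;\mathrm{ddeg}]=\frac{ab}{a+b}+\frac{a-b}{a+b}\left(\sum_{i=1}^{a}(a-i)\,\mathbb E\big[\mu;\mathcal T^+_{(i,i)}\big]-\sum_{i=1}^{a-1} i\,\mathbb E\big[\mu;\mathcal T^-_{\{(i,\lambda_i),(i+1,\lambda_{i+1})\}}\big]\right).$$
   Context: $\mathscr T(a,b)=\{(i,j)\in\mathbb Z^2:1\le i\le a,\ i\le j\le a+b-i\}$ with componentwise order, and $(i,\lambda_i)$ denotes the maximal element of row $i$, i.e. $\lambda_i=a+b-i$. $\mathrm{ddeg}(I)$ is the number of maximal elements of the order ideal $I$. For an antichain $A$ (a single element $p$ being written as $p$): $\mathcal T_A^+(I)=1$ if $A\cap I=\emptyset$ and $I\cup A$ is an order ideal (else $0$); $\mathcal T_A^-(I)=1$ if $A\subseteq I$ and $I\setminus A$ is an order ideal (else $0$); $\mathcal T_A=\mathcal T_A^+-\mathcal T_A^-$. A distribution $\mu$ on $J(\mathscr T(a,b))$ is toggle-symmetric if $\mathbb E[\mu;\mathcal T_{p}]=0$ for every element $p$.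
   Formalization: The toggle-symmetric probability distribution μ on $J(\mathscr T(a,b))$ takes rational values. -}

module Defs where

open import Data.Bool using (Bool; true; false; _∧_; _∨_; not; if_then_else_)
open import Data.Nat as ℕ using (ℕ; zero; suc; _∸_; _≤ᵇ_; _≡ᵇ_)
open import Data.Integer as ℤ using (ℤ; +_)
open import Data.Rational as ℚ using (ℚ; 0ℚ; 1ℚ; _/_)
open import Data.List using (List; []; _∷_; map; concatMap; filterᵇ; length; foldr; upTo; _++_)
open import Data.Bool.ListAction using (all; any)
open import Data.Product using (_×_; _,_)
open import Relation.Binary.PropositionalEquality using (_≡_)

Elem : Set
Elem = ℕ × ℕ

range : ℕ → ℕ → List ℕ
range lo n = map (λ k → lo ℕ.+ k) (upTo n)

-- the elements of 𝒯(a,b): 1 ≤ i ≤ a, i ≤ j ≤ a+b-i (each listed once)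
elems : ℕ → ℕ → List Elem
elems a b = concatMap (λ i → map (λ j → (i , j)) (range i (suc ((a ℕ.+ b) ∸ i) ∸ i))) (range 1 a)

leqᵇ : Elem → Elem → Bool
leqᵇ (i , j) (k , l) = (i ≤ᵇ k) ∧ (j ≤ᵇ l)

eqᵇ : Elem → Elem → Bool
eqᵇ (i , j) (k , l) = (i ≡ᵇ k) ∧ (j ≡ᵇ l)

ltᵇ : Elem → Elem → Bool
ltᵇ p q = leqᵇ p q ∧ not (eqᵇ p q)

memᵇ : Elem → List Elem → Bool
memᵇ p S = any (eqᵇ p) S

inTᵇ : ℕ → ℕ → Elem → Bool
inTᵇ a b (i , j) = (1 ≤ᵇ i) ∧ (i ≤ᵇ a) ∧ (i ≤ᵇ j) ∧ (j ≤ᵇ ((a ℕ.+ b) ∸ i))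

isIdealᵇ : ℕ → ℕ → List Elem → Bool
isIdealᵇ a b S = all (inTᵇ a b) S ∧ all (λ p → all (λ q → not (leqᵇ q p) ∨ memᵇ q S) (elems a b)) S

sublists : {A : Set} → List A → List (List A)
sublists [] = [] ∷ []
sublists (x ∷ xs) = let r = sublists xs in r ++ map (x ∷_) r

-- J(𝒯(a,b)): all order ideals, each listed exactly once
ideals : ℕ → ℕ → List (List Elem)
ideals a b = filterᵇ (isIdealᵇ a b) (sublists (elems a b))

ddeg : List Elem → ℕ
ddeg I = length (filterᵇ (λ p → all (λ q → not (ltᵇ p q)) I) I)

removeAll : List Elem → List Elem → List Elem
removeAll A I = filterᵇ (λ p → not (memᵇ p A)) I

boolℚ : Bool → ℚ
boolℚ true = 1ℚ
boolℚ false = 0ℚ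

natℚ : ℕ → ℚ
natℚ n = + n / 1

T⁺ : ℕ → ℕ → List Elem → List Elem → ℚ
T⁺ a b A I = boolℚ (all (λ p → not (memᵇ p I)) A ∧ isIdealᵇ a b (A ++ I))

T⁻ : ℕ → ℕ → List Elem → List Elem → ℚ
T⁻ a b A I = boolℚ (all (λ p → memᵇ p I) A ∧ isIdealᵇ a b (removeAll A I))

Tog : ℕ → ℕ → List Elem → List Elem → ℚ
Tog a b A I = T⁺ a b A I ℚ.- T⁻ a b A I

sumℚ : List ℚ → ℚ
sumℚ = foldr ℚ._+_ 0ℚ

𝔼 : ℕ → ℕ → (List Elem → ℚ) → (List Elem → ℚ) → ℚ
𝔼 a b μ f = sumℚ (map (λ I → μ I ℚ.* f I) (ideals a b))

-- μ is a probability distribution on J(𝒯(a,b)) (values outside J are irrelevant)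
IsProbDist : ℕ → ℕ → (List Elem → ℚ) → Set
IsProbDist a b μ = ((I : List Elem) → isIdealᵇ a b I ≡ true → 0ℚ ℚ.≤ μ I)
                 × (sumℚ (map μ (ideals a b)) ≡ 1ℚ)

ToggleSymmetric : ℕ → ℕ → (List Elem → ℚ) → Set
ToggleSymmetric a b μ = (p : Elem) → inTᵇ a b p ≡ true → 𝔼 a b μ (Tog a b (p ∷ [])) ≡ 0ℚ

-- z / n as a rational (n assumed nonzero; returns 0 for n = 0)
frac : ℤ → ℕ → ℚ
frac z zero = 0ℚ
frac z (suc n) = z / suc n

lam : ℕ → ℕ → ℕ → ℕ
lam a b i = (a ℕ.+ b) ∸ i

module Submission where

open import Defs
open import Data.Nat using (ℕ; _≤_; _∸_; _+_; _*_)
open import Data.Integer using (+_)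
open import Data.Integer as ℤ using ()
open import Data.Rational as ℚ using (ℚ)
open import Data.List using (List; map; []; _∷_)
open import Data.Product using (_,_)
open import Relation.Binary.PropositionalEquality using (_≡_)

open import Data.Bool using (Bool; true; false; _∧_; _∨_; not; T; T?)
open import Data.Bool.Properties using (T-≡; ¬-not; ∧-zeroʳ; ∧-identityʳ; ∧-comm; ∨-zeroʳ; ∨-assoc)
open import Data.Bool.ListAction using (all)
open import Data.Nat as ℕ using (zero; suc; _≤ᵇ_; _<ᵇ_; _≡ᵇ_; z≤n; s≤s)
import Data.Nat.Properties as ℕₚ
open import Data.Nat.Tactic.RingSolver using () renaming (solve-∀ to ℕ-solve-∀)
open import Data.Integer using (ℤ; 0ℤ; 1ℤ)
import Data.Integer.Properties as ℤₚ
open import Data.Integer.Tactic.RingSolver using (solve-∀; solve)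
open import Data.Rational using (0ℚ; 1ℚ; _/_; toℚᵘ)
import Data.Rational.Properties as ℚₚ
open import Data.Rational.Unnormalised as ℚᵘ using (mkℚᵘ; *≡*)
import Data.Rational.Unnormalised.Properties as ℚᵘₚ
open import Data.Rational.Solver using (module +-*-Solver)
open import Data.List using (concatMap; filterᵇ; length; _++_; applyUpTo; foldr)
open import Data.List.Properties using (map-++; map-∘; map-cong; map-cong-local)
open import Data.List.Relation.Unary.All as All using (All)
import Data.List.Relation.Unary.All.Properties as Allₚ
open import Data.List.Relation.Binary.Sublist.Propositional as Sublist using (_⊆_; _∷ʳ_)
open import Data.Product using (Σ-syntax; _×_; proj₁; proj₂; uncurry)
open import Data.Sum using (_⊎_; inj₁; inj₂)
open import Data.Empty using (⊥; ⊥-elim)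
open import Data.Unit using (⊤; tt)
open import Function using (_∘_)
open import Function.Bundles using (Equivalence)
open import Relation.Binary.Definitions using (tri<; tri≈; tri>)
open import Relation.Binary.PropositionalEquality
open import Relation.Nullary using (Dec; yes; no)

open +-*-Solver using (_:+_; _:*_; _:-_; _:=_; con) renaming (solve to ℚ-solve)

-- An order ideal of 𝒯(a,b) is the same as a sequence of row lengths c₁, c₂, … that strictly decrease
-- while positive, with cᵢ ≤ a + b + 1 − 2i. Every statistic in the statement is a sum over rows of
-- terms read off from three consecutive row lengths: row i has at most one maximal element (its last
-- cell) and at most one addable cell (just after its end). With the weights
--   w(i,j) = a(a + b − j) − (i − 1)b − [i = j](a − i)b
-- a case analysis of these configurations shows that, for each row i,
--   (a + b)·#maxᵢ + Σⱼ w(i,j)·T_(i,j) − (a − b)(a − i)·T⁺_(i,i) + (a − b)(i − 1)·T⁻_{(i−1,λᵢ₋₁),(i,λᵢ)}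
-- equals b + Φᵢ − Φᵢ₊₁ for an explicit potential Φ. Summing over the rows telescopes to ab, so
--   (a + b)·ddeg(I) + Σₚ w(p)·T_p(I) = ab + (a − b)(S₁(I) − S₂(I))
-- for every ideal I, where S₁ and S₂ are the two sums of the statement with T± evaluated at I.
-- Under a toggle-symmetric μ the expectation of Σₚ w(p)·T_p vanishes; dividing by a + b gives the result.


-- Boolean reflection of ℕ comparisons and sums over ranges

true≢false : true ≢ false
true≢false ()

T⇒≡true : ∀ {x} → T x → x ≡ true
T⇒≡true = Equivalence.to T-≡

≡true⇒T : ∀ {x} → x ≡ true → T x
≡true⇒T = Equivalence.from T-≡

≤⇒≤ᵇ≡true : ∀ {m n} → m ℕ.≤ n → (m ≤ᵇ n) ≡ true
≤⇒≤ᵇ≡true p = T⇒≡true (ℕₚ.≤⇒≤ᵇ p)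

<⇒<ᵇ≡true : ∀ {m n} → m ℕ.< n → (m <ᵇ n) ≡ true
<⇒<ᵇ≡true p = T⇒≡true (ℕₚ.<⇒<ᵇ p)

≡⇒≡ᵇ≡true : ∀ {m n} → m ≡ n → (m ≡ᵇ n) ≡ true
≡⇒≡ᵇ≡true {m} {n} p = T⇒≡true (ℕₚ.≡⇒≡ᵇ m n p)

≤ᵇ≡true⇒≤ : ∀ {m n} → (m ≤ᵇ n) ≡ true → m ℕ.≤ n
≤ᵇ≡true⇒≤ {m} {n} e = ℕₚ.≤ᵇ⇒≤ m n (≡true⇒T e)

<ᵇ≡true⇒< : ∀ {m n} → (m <ᵇ n) ≡ true → m ℕ.< n
<ᵇ≡true⇒< {m} {n} e = ℕₚ.<ᵇ⇒< m n (≡true⇒T e)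

≡ᵇ≡true⇒≡ : ∀ {m n} → (m ≡ᵇ n) ≡ true → m ≡ n
≡ᵇ≡true⇒≡ {m} {n} e = ℕₚ.≡ᵇ⇒≡ m n (≡true⇒T e)

>⇒≤ᵇ≡false : ∀ {m n} → n ℕ.< m → (m ≤ᵇ n) ≡ false
>⇒≤ᵇ≡false p = ¬-not (λ e → ℕₚ.<⇒≱ p (≤ᵇ≡true⇒≤ e))

≥⇒<ᵇ≡false : ∀ {m n} → n ℕ.≤ m → (m <ᵇ n) ≡ false
≥⇒<ᵇ≡false p = ¬-not (λ e → ℕₚ.≤⇒≯ p (<ᵇ≡true⇒< e))

≢⇒≡ᵇ≡false : ∀ {m n} → m ≢ n → (m ≡ᵇ n) ≡ false
≢⇒≡ᵇ≡false p = ¬-not (λ e → p (≡ᵇ≡true⇒≡ e))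

≢⇒<ᵇ≡≤ᵇ : ∀ {m n} → m ≢ n → (m <ᵇ n) ≡ (m ≤ᵇ n)
≢⇒<ᵇ≡≤ᵇ {m} {n} m≢n with ℕₚ.<-cmp m n
... | tri< m<n _ _ = trans (<⇒<ᵇ≡true m<n) (sym (≤⇒≤ᵇ≡true (ℕₚ.<⇒≤ m<n)))
... | tri≈ _ m≡n _ = ⊥-elim (m≢n m≡n)
... | tri> _ _ m>n = trans (≥⇒<ᵇ≡false (ℕₚ.<⇒≤ m>n)) (sym (>⇒≤ᵇ≡false m>n))

∧≡true⁻ˡ : ∀ {x y} → (x ∧ y) ≡ true → x ≡ true
∧≡true⁻ˡ {true} _ = refl

∧≡true⁻ʳ : ∀ {x y} → (x ∧ y) ≡ true → y ≡ true
∧≡true⁻ʳ {true} e = e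

∧≡true⁺ : ∀ {x y} → x ≡ true → y ≡ true → (x ∧ y) ≡ true
∧≡true⁺ refl refl = refl

not≡true⇒≡false : ∀ {x} → not x ≡ true → x ≡ false
not≡true⇒≡false {false} _ = refl

∨≡true⁻ : ∀ {x y} → (x ∨ y) ≡ true → (x ≡ true) ⊎ (y ≡ true)
∨≡true⁻ {true} _ = inj₁ refl
∨≡true⁻ {false} e = inj₂ e

∨≡true-resolveˡ : ∀ {x y} → (x ∨ y) ≡ true → x ≡ false → y ≡ true
∨≡true-resolveˡ e refl = e

≡true⇔≡true⇒≡ : ∀ {x y : Bool} → (x ≡ true → y ≡ true) → (y ≡ true → x ≡ true) → x ≡ y
≡true⇔≡true⇒≡ {true} {true} _ _ = refl
≡true⇔≡true⇒≡ {true} {false} f _ = sym (f refl)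
≡true⇔≡true⇒≡ {false} {true} _ g = g refl
≡true⇔≡true⇒≡ {false} {false} _ _ = refl

𝟙 : Bool → ℤ
𝟙 true = 1ℤ
𝟙 false = 0ℤ

sumRange : (ℕ → ℤ) → ℕ → ℕ → ℤ
sumRange f lo zero = 0ℤ
sumRange f lo (suc k) = f lo ℤ.+ sumRange f (suc lo) k

sumRange-+ : ∀ f g lo k → sumRange (λ i → f i ℤ.+ g i) lo k ≡ sumRange f lo k ℤ.+ sumRange g lo k
sumRange-+ f g lo zero = refl
sumRange-+ f g lo (suc k) rewrite sumRange-+ f g (suc lo) k =
  interchange (f lo) (g lo) (sumRange f (suc lo) k) (sumRange g (suc lo) k)
  where
  interchange : ∀ x y u v → x ℤ.+ y ℤ.+ (u ℤ.+ v) ≡ x ℤ.+ u ℤ.+ (y ℤ.+ v)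
  interchange = solve-∀

sumRange-- : ∀ f g lo k → sumRange (λ i → f i ℤ.- g i) lo k ≡ sumRange f lo k ℤ.- sumRange g lo k
sumRange-- f g lo zero = refl
sumRange-- f g lo (suc k) rewrite sumRange-- f g (suc lo) k =
  interchange (f lo) (g lo) (sumRange f (suc lo) k) (sumRange g (suc lo) k)
  where
  interchange : ∀ x y u v → x ℤ.- y ℤ.+ (u ℤ.- v) ≡ x ℤ.+ u ℤ.- (y ℤ.+ v)
  interchange = solve-∀

sumRange-* : ∀ c f lo k → sumRange (λ i → c ℤ.* f i) lo k ≡ c ℤ.* sumRange f lo k
sumRange-* c f lo zero = sym (ℤₚ.*-zeroʳ c)
sumRange-* c f lo (suc k) rewrite sumRange-* c f (suc lo) k = sym (ℤₚ.*-distribˡ-+ c (f lo) _)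

sumRange-cong : ∀ f g lo k → (∀ i → lo ℕ.≤ i → i ℕ.< lo ℕ.+ k → f i ≡ g i) →
  sumRange f lo k ≡ sumRange g lo k
sumRange-cong f g lo zero _ = refl
sumRange-cong f g lo (suc k) f≡g =
  cong₂ ℤ._+_ (f≡g lo ℕₚ.≤-refl (ℕₚ.m<m+n lo (s≤s z≤n)))
    (sumRange-cong f g (suc lo) k
      (λ i lo<i i<hi → f≡g i (ℕₚ.<⇒≤ lo<i) (subst (i ℕ.<_) (sym (ℕₚ.+-suc lo k)) i<hi)))

sumRange-const : ∀ c lo k → sumRange (λ _ → c) lo k ≡ + k ℤ.* c
sumRange-const c lo zero = sym (ℤₚ.*-zeroˡ c)
sumRange-const c lo (suc k) rewrite sumRange-const c (suc lo) k = step c (+ k)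
  where
  step : ∀ c k → c ℤ.+ k ℤ.* c ≡ (1ℤ ℤ.+ k) ℤ.* c
  step = solve-∀

sumRange-shift : ∀ f lo k → sumRange f (suc lo) k ≡ sumRange (λ i → f (suc i)) lo k
sumRange-shift f lo zero = refl
sumRange-shift f lo (suc k) = cong (λ s → f (suc lo) ℤ.+ s) (sumRange-shift f (suc lo) k)

sumRange-telescope : ∀ (Φ : ℕ → ℤ) lo k → sumRange (λ i → Φ i ℤ.- Φ (suc i)) lo k ≡ Φ lo ℤ.- Φ (lo ℕ.+ k)
sumRange-telescope Φ lo zero rewrite ℕₚ.+-identityʳ lo = sym (ℤₚ.+-inverseʳ (Φ lo))
sumRange-telescope Φ lo (suc k) rewrite sumRange-telescope Φ (suc lo) k | ℕₚ.+-suc lo k =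
  cancel (Φ lo) (Φ (suc lo)) (Φ (suc (lo ℕ.+ k)))
  where
  cancel : ∀ x y z → x ℤ.- y ℤ.+ (y ℤ.- z) ≡ x ℤ.- z
  cancel = solve-∀

sumRange-pred : ∀ f k → f 0 ≡ 0ℤ → sumRange (λ i → f (i ∸ 1)) 1 k ≡ sumRange f 1 (k ∸ 1)
sumRange-pred f zero _ = refl
sumRange-pred f (suc k) f0≡0 =
  trans (cong₂ ℤ._+_ f0≡0 (sumRange-shift (λ i → f (i ∸ 1)) 1 k)) (ℤₚ.+-identityˡ _)

empty-rangeᵇ : ∀ lo t → ((lo ≤ᵇ t) ∧ (t <ᵇ lo ℕ.+ 0)) ≡ false
empty-rangeᵇ lo t with lo ≤ᵇ t in lo≤t
... | false = refl
... | true = ≥⇒<ᵇ≡false (subst (ℕ._≤ t) (sym (ℕₚ.+-identityʳ lo)) (≤ᵇ≡true⇒≤ lo≤t))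

sumRange-indicator : ∀ (B : ℕ → Bool) (H : ℕ → ℤ) t lo k → (∀ j → B j ≡ true → j ≡ t) →
  sumRange (λ j → 𝟙 (B j) ℤ.* H j) lo k ≡ 𝟙 (B t ∧ (lo ≤ᵇ t) ∧ (t <ᵇ lo ℕ.+ k)) ℤ.* H t
sumRange-indicator B H t lo zero _
  rewrite empty-rangeᵇ lo t | ∧-zeroʳ (B t) = sym (ℤₚ.*-zeroˡ (H t))
sumRange-indicator B H t lo (suc k) only-t
  rewrite sumRange-indicator B H t (suc lo) k only-t | ℕₚ.+-suc lo k with lo ℕₚ.≟ t
... | yes refl rewrite >⇒≤ᵇ≡false (ℕₚ.n<1+n lo) | ∧-zeroʳ (B lo)
                     | ≤⇒≤ᵇ≡true (ℕₚ.≤-refl {lo}) | <⇒<ᵇ≡true (s≤s (ℕₚ.m≤m+n lo k)) | ∧-identityʳ (B lo)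
  = ℤₚ.+-identityʳ _
... | no lo≢t rewrite ≢⇒<ᵇ≡≤ᵇ lo≢t | ¬-not (λ e → lo≢t (only-t lo e)) = ℤₚ.+-identityˡ _

downClosed⇒initialSegment : ∀ (f : ℕ → Bool) lo M →
  (∀ j → f j ≡ true → (lo ℕ.≤ j) × (j ℕ.< lo ℕ.+ M)) →
  (∀ j j′ → f j ≡ true → lo ℕ.≤ j′ → j′ ℕ.≤ j → f j′ ≡ true) →
  Σ[ c ∈ ℕ ] (c ℕ.≤ M) × (∀ j → f j ≡ ((lo ≤ᵇ j) ∧ (j <ᵇ lo ℕ.+ c)))
downClosed⇒initialSegment f lo zero supp _ = 0 , z≤n , λ j →
  trans (¬-not (λ fj → ℕₚ.<-irrefl refl
                 (ℕₚ.<-≤-trans (proj₂ (supp j fj)) (ℕₚ.≤-trans (ℕₚ.≤-reflexive (ℕₚ.+-identityʳ lo)) (proj₁ (supp j fj))))))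
        (sym (empty-rangeᵇ lo j))
downClosed⇒initialSegment f lo (suc M) supp closed with f (lo ℕ.+ M) in top
... | true = suc M , ℕₚ.≤-refl , λ j → ≡true⇔≡true⇒≡
  (λ fj → ∧≡true⁺ (≤⇒≤ᵇ≡true (proj₁ (supp j fj))) (<⇒<ᵇ≡true (proj₂ (supp j fj))))
  (λ j∈ → closed (lo ℕ.+ M) j top (≤ᵇ≡true⇒≤ (∧≡true⁻ˡ j∈))
            (ℕₚ.≤-pred (subst (j ℕ.<_) (ℕₚ.+-suc lo M) (<ᵇ≡true⇒< (∧≡true⁻ʳ {lo ≤ᵇ j} j∈)))))
... | false with downClosed⇒initialSegment f lo M (λ j fj → proj₁ (supp j fj) , below-top j fj) closed
  where
  below-top : ∀ j → f j ≡ true → j ℕ.< lo ℕ.+ M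
  below-top j fj = ℕₚ.≤∧≢⇒< (ℕₚ.≤-pred (subst (j ℕ.<_) (ℕₚ.+-suc lo M) (proj₂ (supp j fj))))
                            (λ { refl → true≢false (trans (sym fj) top) })
...   | c , c≤M , spec = c , ℕₚ.m≤n⇒m≤1+n c≤M , spec


-- The row identity

[m≡ᵇm+n]≡[n≡ᵇ0] : ∀ m n → (m ≡ᵇ m ℕ.+ n) ≡ (n ≡ᵇ 0)
[m≡ᵇm+n]≡[n≡ᵇ0] zero zero = refl
[m≡ᵇm+n]≡[n≡ᵇ0] zero (suc n) = refl
[m≡ᵇm+n]≡[n≡ᵇ0] (suc m) n = [m≡ᵇm+n]≡[n≡ᵇ0] m n

[1+n≤ᵇ1]≡[n≡ᵇ0] : ∀ n → (suc n ≤ᵇ 1) ≡ (n ≡ᵇ 0)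
[1+n≤ᵇ1]≡[n≡ᵇ0] zero = refl
[1+n≤ᵇ1]≡[n≡ᵇ0] (suc n) = refl

m+[1+n]∸1≡m+n : ∀ m n → m ℕ.+ suc n ∸ 1 ≡ m ℕ.+ n
m+[1+n]∸1≡m+n m n = cong (_∸ 1) (ℕₚ.+-suc m n)

pos-suc : ∀ n → + suc n ≡ + n ℤ.+ 1ℤ
pos-suc n = trans (cong +_ (ℕₚ.+-comm 1 n)) (ℤₚ.pos-+ n 1)

-- The row identity for the five configurations of a row of length c under a row of length p, with an
-- empty row below: empty row, diagonal cell addable, last cell blocked by the row above (p = c + 1),
-- cell after the end addable, full row (forcing p = c + 2). The W arguments are weights multiplied by 0.
emptyRow-identity : ∀ A B I K W₀ W₁ W₂ → I ≡ K ℤ.+ 1ℤ →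
  0ℤ ℤ.* ((A ℤ.+ B) ℤ.- W₁) ℤ.+ (0ℤ ℤ.* W₀ ℤ.- (A ℤ.- B) ℤ.* ((A ℤ.- I) ℤ.* 0ℤ) ℤ.+ (A ℤ.- B) ℤ.* ((I ℤ.- 1ℤ) ℤ.* 0ℤ))
  ≡ B ℤ.+ (0ℤ ℤ.* ((A ℤ.+ B) ℤ.- W₂) ℤ.- 1ℤ ℤ.* ((A ℤ.- K) ℤ.* B))
      ℤ.- (0ℤ ℤ.* ((A ℤ.+ B) ℤ.- W₁) ℤ.- 1ℤ ℤ.* ((A ℤ.- I) ℤ.* B))
emptyRow-identity A B .(K ℤ.+ 1ℤ) K W₀ W₁ W₂ refl = solve (A ∷ B ∷ K ∷ W₀ ∷ W₁ ∷ W₂ ∷ [])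

diagonalRow-identity : ∀ A B I K W₀ W₁ →
  0ℤ ℤ.* ((A ℤ.+ B) ℤ.- W₀)
    ℤ.+ (1ℤ ℤ.* (A ℤ.* ((A ℤ.+ B) ℤ.- I ℤ.- 0ℤ) ℤ.- (I ℤ.- 1ℤ) ℤ.* B ℤ.- 1ℤ ℤ.* ((A ℤ.- I) ℤ.* B))
         ℤ.- (A ℤ.- B) ℤ.* ((A ℤ.- I) ℤ.* 1ℤ) ℤ.+ (A ℤ.- B) ℤ.* ((I ℤ.- 1ℤ) ℤ.* 0ℤ))
  ≡ B ℤ.+ (0ℤ ℤ.* ((A ℤ.+ B) ℤ.- W₁) ℤ.- 0ℤ ℤ.* ((A ℤ.- K) ℤ.* B))
      ℤ.- (0ℤ ℤ.* ((A ℤ.+ B) ℤ.- W₀) ℤ.- 1ℤ ℤ.* ((A ℤ.- I) ℤ.* B))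
diagonalRow-identity = solve-∀

blockedRow-identity : ∀ A B I K E E₁ X Wa Wr Wp → I ≡ K ℤ.+ 1ℤ → E₁ ≡ E ℤ.+ 1ℤ →
  Wr ≡ A ℤ.* ((A ℤ.+ B) ℤ.- I ℤ.- E) ℤ.- (I ℤ.- 1ℤ) ℤ.* B ℤ.- X ℤ.* ((A ℤ.- I) ℤ.* B) →
  Wp ≡ A ℤ.* ((A ℤ.+ B) ℤ.- K ℤ.- E₁) ℤ.- (K ℤ.- 1ℤ) ℤ.* B ℤ.- 0ℤ ℤ.* ((A ℤ.- K) ℤ.* B) →
  1ℤ ℤ.* ((A ℤ.+ B) ℤ.- Wr) ℤ.+ (0ℤ ℤ.* Wa ℤ.- (A ℤ.- B) ℤ.* ((A ℤ.- I) ℤ.* 0ℤ) ℤ.+ (A ℤ.- B) ℤ.* ((I ℤ.- 1ℤ) ℤ.* 0ℤ))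
  ≡ B ℤ.+ (1ℤ ℤ.* ((A ℤ.+ B) ℤ.- Wp) ℤ.- 0ℤ ℤ.* ((A ℤ.- K) ℤ.* B))
      ℤ.- (0ℤ ℤ.* ((A ℤ.+ B) ℤ.- Wr) ℤ.- X ℤ.* ((A ℤ.- I) ℤ.* B))
blockedRow-identity A B .(K ℤ.+ 1ℤ) K E .(E ℤ.+ 1ℤ) X Wa _ _ refl refl refl refl = solve (A ∷ B ∷ K ∷ E ∷ X ∷ Wa ∷ [])

addableRow-identity : ∀ A B I K E E₁ X Wa Wr Wp → E₁ ≡ E ℤ.+ 1ℤ →
  Wa ≡ A ℤ.* ((A ℤ.+ B) ℤ.- I ℤ.- E₁) ℤ.- (I ℤ.- 1ℤ) ℤ.* B ℤ.- 0ℤ ℤ.* ((A ℤ.- I) ℤ.* B) →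
  Wr ≡ A ℤ.* ((A ℤ.+ B) ℤ.- I ℤ.- E) ℤ.- (I ℤ.- 1ℤ) ℤ.* B ℤ.- X ℤ.* ((A ℤ.- I) ℤ.* B) →
  1ℤ ℤ.* ((A ℤ.+ B) ℤ.- Wr) ℤ.+ (1ℤ ℤ.* Wa ℤ.- (A ℤ.- B) ℤ.* ((A ℤ.- I) ℤ.* 0ℤ) ℤ.+ (A ℤ.- B) ℤ.* ((I ℤ.- 1ℤ) ℤ.* 0ℤ))
  ≡ B ℤ.+ (0ℤ ℤ.* ((A ℤ.+ B) ℤ.- Wp) ℤ.- 0ℤ ℤ.* ((A ℤ.- K) ℤ.* B))
      ℤ.- (0ℤ ℤ.* ((A ℤ.+ B) ℤ.- Wr) ℤ.- X ℤ.* ((A ℤ.- I) ℤ.* B))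
addableRow-identity A B I K E .(E ℤ.+ 1ℤ) X _ _ Wp refl refl refl = solve (A ∷ B ∷ I ∷ K ∷ E ∷ X ∷ Wp ∷ [])

fullRow-identity : ∀ A B I K E X Wa Wr Wp → B ≡ E ℤ.+ I ℤ.+ I ℤ.- A →
  Wr ≡ A ℤ.* ((A ℤ.+ B) ℤ.- I ℤ.- E) ℤ.- (I ℤ.- 1ℤ) ℤ.* B ℤ.- X ℤ.* ((A ℤ.- I) ℤ.* B) →
  1ℤ ℤ.* ((A ℤ.+ B) ℤ.- Wr) ℤ.+ (0ℤ ℤ.* Wa ℤ.- (A ℤ.- B) ℤ.* ((A ℤ.- I) ℤ.* 0ℤ) ℤ.+ (A ℤ.- B) ℤ.* ((I ℤ.- 1ℤ) ℤ.* 1ℤ))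
  ≡ B ℤ.+ (0ℤ ℤ.* ((A ℤ.+ B) ℤ.- Wp) ℤ.- 0ℤ ℤ.* ((A ℤ.- K) ℤ.* B))
      ℤ.- (0ℤ ℤ.* ((A ℤ.+ B) ℤ.- Wr) ℤ.- X ℤ.* ((A ℤ.- I) ℤ.* B))
fullRow-identity A .(E ℤ.+ I ℤ.+ I ℤ.- A) I K E X Wa _ Wp refl refl = solve (A ∷ I ∷ K ∷ E ∷ X ∷ Wa ∷ Wp ∷ [])

module Rows (a b : ℕ) where

  n : ℕ
  n = a ℕ.+ b

  N : ℤ
  N = + a ℤ.+ + b

  len : ℕ → ℕ
  len i = suc (n ∸ i) ∸ i

  w : ℕ → ℕ → ℤ
  w i j = + a ℤ.* (N ℤ.- + j) ℤ.- (+ i ℤ.- 1ℤ) ℤ.* + b ℤ.- 𝟙 (i ≡ᵇ j) ℤ.* ((+ a ℤ.- + i) ℤ.* + b)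

  w-along-row : ∀ i c → w i (i ℕ.+ c) ≡
    + a ℤ.* (N ℤ.- + i ℤ.- + c) ℤ.- (+ i ℤ.- 1ℤ) ℤ.* + b ℤ.- 𝟙 (c ≡ᵇ 0) ℤ.* ((+ a ℤ.- + i) ℤ.* + b)
  w-along-row i c rewrite ℤₚ.pos-+ i c | [m≡ᵇm+n]≡[n≡ᵇ0] i c = reassoc (+ a) (+ b) (+ i) (+ c) (𝟙 (c ≡ᵇ 0))
    where
    reassoc : ∀ A B I C X → A ℤ.* ((A ℤ.+ B) ℤ.- (I ℤ.+ C)) ℤ.- (I ℤ.- 1ℤ) ℤ.* B ℤ.- X ℤ.* ((A ℤ.- I) ℤ.* B)
                          ≡ A ℤ.* ((A ℤ.+ B) ℤ.- I ℤ.- C) ℤ.- (I ℤ.- 1ℤ) ℤ.* B ℤ.- X ℤ.* ((A ℤ.- I) ℤ.* B)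
    reassoc = solve-∀

  covered : ℕ → ℕ → Bool
  covered c d = (0 <ᵇ d) ∧ (c ≡ᵇ suc d)

  hasRemovable : ℕ → ℕ → Bool
  hasRemovable c d = (0 <ᵇ c) ∧ not (covered c d)

  hasAddable : ℕ → ℕ → ℕ → Bool
  hasAddable L p c = (suc c <ᵇ p) ∧ (c <ᵇ L)

  diagonalAddable : ℕ → ℕ → Bool
  diagonalAddable p c = (c ≡ᵇ 0) ∧ (1 <ᵇ p)

  bothFull : ℕ → ℕ → ℕ → Bool
  bothFull L p c = (c ≡ᵇ L) ∧ (p ≡ᵇ suc (suc L))

  -- Potential across the boundary between row k (length c) and row k + 1 (length d). Its first term is
  -- what row k loses when row k + 1 covers its last cell, which then stops being maximal.
  Φ : ℕ → ℕ → ℕ → ℤ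
  Φ k c d = 𝟙 (covered c d) ℤ.* (N ℤ.- w k (k ℕ.+ c ∸ 1)) ℤ.- 𝟙 (c ≤ᵇ 1) ℤ.* ((+ a ℤ.- + k) ℤ.* + b)

  w-removable : ∀ i e → w i (i ℕ.+ suc e ∸ 1) ≡
    + a ℤ.* (N ℤ.- + i ℤ.- + e) ℤ.- (+ i ℤ.- 1ℤ) ℤ.* + b ℤ.- 𝟙 (suc e ≤ᵇ 1) ℤ.* ((+ a ℤ.- + i) ℤ.* + b)
  w-removable i e = trans (cong (w i) (m+[1+n]∸1≡m+n i e)) (trans (w-along-row i e)
    (cong (λ t → + a ℤ.* (N ℤ.- + i ℤ.- + e) ℤ.- (+ i ℤ.- 1ℤ) ℤ.* + b ℤ.- 𝟙 t ℤ.* ((+ a ℤ.- + i) ℤ.* + b))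
          (sym ([1+n≤ᵇ1]≡[n≡ᵇ0] e))))

  b-from-size : ∀ e i → e ℕ.+ 2 ℕ.* i ≡ n → + b ≡ + e ℤ.+ + i ℤ.+ + i ℤ.- + a
  b-from-size e i size = begin
    + b                          ≡⟨ cancel (+ a) (+ b) ⟩
    + a ℤ.+ + b ℤ.- + a          ≡⟨ cong (ℤ._- + a) (sym (ℤₚ.pos-+ a b)) ⟩
    + n ℤ.- + a                  ≡⟨ cong (λ m → + m ℤ.- + a) (sym size) ⟩
    + (e ℕ.+ 2 ℕ.* i) ℤ.- + a    ≡⟨ cong (ℤ._- + a) (trans (ℤₚ.pos-+ e (2 ℕ.* i)) (cong (λ t → + e ℤ.+ t) (ℤₚ.pos-* 2 i))) ⟩
    + e ℤ.+ + 2 ℤ.* + i ℤ.- + a  ≡⟨ double (+ e) (+ i) (+ a) ⟩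
    + e ℤ.+ + i ℤ.+ + i ℤ.- + a  ∎
    where
    open ≡-Reasoning
    cancel : ∀ A B → B ≡ A ℤ.+ B ℤ.- A
    cancel = solve-∀
    double : ∀ E I A → E ℤ.+ (1ℤ ℤ.+ 1ℤ) ℤ.* I ℤ.- A ≡ E ℤ.+ I ℤ.+ I ℤ.- A
    double = solve-∀

  rowContribution : ℕ → ℕ → ℕ → ℕ → ℕ → ℤ
  rowContribution i L p c d =
    𝟙 (hasRemovable c d) ℤ.* (N ℤ.- w i (i ℕ.+ c ∸ 1))
    ℤ.+ (𝟙 (hasAddable L p c) ℤ.* w i (i ℕ.+ c)
         ℤ.- (+ a ℤ.- + b) ℤ.* ((+ a ℤ.- + i) ℤ.* 𝟙 (diagonalAddable p c))
         ℤ.+ (+ a ℤ.- + b) ℤ.* ((+ i ℤ.- 1ℤ) ℤ.* 𝟙 (bothFull L p c)))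

  rowIdentity-emptyBelow : ∀ k L p c → 1 ℕ.≤ L → L ℕ.+ 2 ℕ.* suc k ≡ suc n →
    c ℕ.≤ L → c ℕ.≤ p ∸ 1 → p ℕ.≤ suc (suc L) →
    rowContribution (suc k) L p c 0 ≡ + b ℤ.+ Φ k p c ℤ.- Φ (suc k) c 0
  rowIdentity-emptyBelow k (suc L) zero zero _ _ _ _ _ =
    emptyRow-identity (+ a) (+ b) (+ suc k) (+ k) (w (suc k) (suc k ℕ.+ 0)) (w (suc k) (suc k ℕ.+ 0 ∸ 1)) (w k (k ℕ.+ 0 ∸ 1)) (pos-suc k)
  rowIdentity-emptyBelow k (suc L) (suc zero) zero _ _ _ _ _ =
    emptyRow-identity (+ a) (+ b) (+ suc k) (+ k) (w (suc k) (suc k ℕ.+ 0)) (w (suc k) (suc k ℕ.+ 0 ∸ 1)) (w k (k ℕ.+ 1 ∸ 1)) (pos-suc k)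
  rowIdentity-emptyBelow k (suc L) (suc (suc p)) zero _ _ _ _ _
    rewrite w-along-row (suc k) 0 = diagonalRow-identity (+ a) (+ b) (+ suc k) (+ k) (w (suc k) (suc k ℕ.+ 0 ∸ 1)) (w k (k ℕ.+ suc (suc p) ∸ 1))
  rowIdentity-emptyBelow k L zero (suc e) _ _ _ () _
  rowIdentity-emptyBelow k L (suc p) (suc e) _ size e<L e<p p≤ with ℕₚ.m≤n⇒m<n∨m≡n e<p
  ... | inj₂ refl rewrite ≥⇒<ᵇ≡false (ℕₚ.≤-refl {e}) | ≢⇒≡ᵇ≡false {e} {L} (λ { refl → ℕₚ.<-irrefl refl e<L })
                        | ∧-zeroʳ (suc e ≡ᵇ L) | ≡⇒≡ᵇ≡true {e} refl
    = blockedRow-identity (+ a) (+ b) (+ suc k) (+ k) (+ e) (+ suc e) (𝟙 (suc e ≤ᵇ 1))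
        (w (suc k) (suc k ℕ.+ suc e)) (w (suc k) (suc k ℕ.+ suc e ∸ 1)) (w k (k ℕ.+ suc (suc e) ∸ 1))
        (pos-suc k) (pos-suc e) (w-removable (suc k) e) (w-removable k (suc e))
  ... | inj₁ e<p′ with ℕₚ.m≤n⇒m<n∨m≡n e<L
  ...   | inj₁ e<L′ rewrite <⇒<ᵇ≡true e<p′ | <⇒<ᵇ≡true e<L′ | ≢⇒≡ᵇ≡false (ℕₚ.<⇒≢ e<L′)
                          | ≢⇒≡ᵇ≡false {p} {suc e} (ℕₚ.>⇒≢ e<p′) | ≥⇒<ᵇ≡false (ℕₚ.<-≤-trans (s≤s z≤n) e<p′)
    = addableRow-identity (+ a) (+ b) (+ suc k) (+ k) (+ e) (+ suc e) (𝟙 (suc e ≤ᵇ 1))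
        (w (suc k) (suc k ℕ.+ suc e)) (w (suc k) (suc k ℕ.+ suc e ∸ 1)) (w k (k ℕ.+ suc p ∸ 1))
        (pos-suc e) (w-along-row (suc k) (suc e)) (w-removable (suc k) e)
  ...   | inj₂ refl with ℕₚ.≤-antisym (ℕₚ.≤-pred p≤) e<p′
  ...     | refl rewrite <⇒<ᵇ≡true (ℕₚ.n<1+n e) | ≥⇒<ᵇ≡false (ℕₚ.≤-refl {e}) | ≡⇒≡ᵇ≡true {e} refl
                   | ≢⇒≡ᵇ≡false {suc e} {e} (ℕₚ.>⇒≢ (ℕₚ.n<1+n e))
    = fullRow-identity (+ a) (+ b) (+ suc k) (+ k) (+ e) (𝟙 (suc e ≤ᵇ 1))
        (w (suc k) (suc k ℕ.+ suc e)) (w (suc k) (suc k ℕ.+ suc e ∸ 1)) (w k (k ℕ.+ suc (suc (suc e)) ∸ 1))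
        (b-from-size e (suc k) (ℕₚ.suc-injective size)) (w-removable (suc k) e)

  𝟙-hasRemovable : ∀ c d → 𝟙 (hasRemovable c d) ≡ 𝟙 (0 <ᵇ c) ℤ.- 𝟙 (covered c d)
  𝟙-hasRemovable zero zero = refl
  𝟙-hasRemovable zero (suc d) = refl
  𝟙-hasRemovable (suc c) d with covered (suc c) d
  ... | true = refl
  ... | false = refl

  -- A row below that covers the last cell changes both sides by the same amount: 𝟙 (covered c d) times
  -- N minus the weight of that cell.
  rowIdentity : ∀ k L p c d → 1 ℕ.≤ L → L ℕ.+ 2 ℕ.* suc k ≡ suc n →
    c ℕ.≤ L → c ℕ.≤ p ∸ 1 → p ℕ.≤ suc (suc L) →
    rowContribution (suc k) L p c d ≡ + b ℤ.+ Φ k p c ℤ.- Φ (suc k) c d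
  rowIdentity k L p c d 1≤L size c≤L c≤p p≤L+2 =
    coverShift (𝟙 (0 <ᵇ c)) _ _ (𝟙 (covered c d)) (N ℤ.- w (suc k) (suc k ℕ.+ c ∸ 1)) _ (+ b) (Φ k p c) _
      (𝟙-hasRemovable c 0) (𝟙-hasRemovable c d) (rowIdentity-emptyBelow k L p c 1≤L size c≤L c≤p p≤L+2)
    where
    coverShift : ∀ x R₀ R Cv M Rest B Φp Z → R₀ ≡ x ℤ.- 0ℤ → R ≡ x ℤ.- Cv →
      R₀ ℤ.* M ℤ.+ Rest ≡ B ℤ.+ Φp ℤ.- (0ℤ ℤ.* M ℤ.- Z) → R ℤ.* M ℤ.+ Rest ≡ B ℤ.+ Φp ℤ.- (Cv ℤ.* M ℤ.- Z)
    coverShift x _ _ Cv M Rest B Φp Z refl refl emptyBelow = begin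
      (x ℤ.- Cv) ℤ.* M ℤ.+ Rest                              ≡⟨ split x Cv M Rest ⟩
      ((x ℤ.- 0ℤ) ℤ.* M ℤ.+ Rest) ℤ.- Cv ℤ.* M               ≡⟨ cong (ℤ._- Cv ℤ.* M) emptyBelow ⟩
      (B ℤ.+ Φp ℤ.- (0ℤ ℤ.* M ℤ.- Z)) ℤ.- Cv ℤ.* M            ≡⟨ merge B Φp Cv M Z ⟩
      B ℤ.+ Φp ℤ.- (Cv ℤ.* M ℤ.- Z)                          ∎
      where
      open ≡-Reasoning
      split : ∀ x Cv M Rest → (x ℤ.- Cv) ℤ.* M ℤ.+ Rest ≡ ((x ℤ.- 0ℤ) ℤ.* M ℤ.+ Rest) ℤ.- Cv ℤ.* M
      split = solve-∀
      merge : ∀ B Φp Cv M Z → (B ℤ.+ Φp ℤ.- (0ℤ ℤ.* M ℤ.- Z)) ℤ.- Cv ℤ.* M ≡ B ℤ.+ Φp ℤ.- (Cv ℤ.* M ℤ.- Z)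
      merge = solve-∀


-- Row-length profiles

+<ᵇ+ : ∀ m x y → (m ℕ.+ x <ᵇ m ℕ.+ y) ≡ (x <ᵇ y)
+<ᵇ+ zero x y = refl
+<ᵇ+ (suc m) x y = +<ᵇ+ m x y

module Profile (a b : ℕ) (r : ℕ → ℕ) where

  open Rows a b public

  filledᵇ : ℕ → ℕ → Bool
  filledᵇ i j = (i ≤ᵇ j) ∧ (j <ᵇ i ℕ.+ r i)

  maximalᵇ : ℕ → ℕ → Bool
  maximalᵇ i j = filledᵇ i j ∧ not (filledᵇ (suc i) j) ∧ not (filledᵇ i (suc j))

  addableᵇ : ℕ → ℕ → Bool
  addableᵇ i j = not (filledᵇ i j) ∧ ((i ≡ᵇ 1) ∨ filledᵇ (i ∸ 1) j) ∧ ((j ≡ᵇ i) ∨ filledᵇ i (j ∸ 1))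

  -- Row 1 is placed under a fictitious row of length n + 1, which never blocks it.
  lengthAbove : ℕ → ℕ
  lengthAbove (suc (suc k)) = r (suc k)
  lengthAbove _ = suc n

  filled-intro : ∀ {i j} → i ℕ.≤ j → j ℕ.< i ℕ.+ r i → filledᵇ i j ≡ true
  filled-intro i≤j j<end rewrite ≤⇒≤ᵇ≡true i≤j | <⇒<ᵇ≡true j<end = refl

  filled-left : ∀ {i j} → j ℕ.< i → filledᵇ i j ≡ false
  filled-left j<i rewrite >⇒≤ᵇ≡false j<i = refl

  filled-right : ∀ {i j} → i ℕ.+ r i ℕ.≤ j → filledᵇ i j ≡ false
  filled-right {i} {j} end≤j rewrite ≥⇒<ᵇ≡false end≤j = ∧-zeroʳ (i ≤ᵇ j)

  filled⇒≤ : ∀ i j → filledᵇ i j ≡ true → i ℕ.≤ j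
  filled⇒≤ i j e = ≤ᵇ≡true⇒≤ (∧≡true⁻ˡ {i ≤ᵇ j} e)

  filled⇒< : ∀ i j → filledᵇ i j ≡ true → j ℕ.< i ℕ.+ r i
  filled⇒< i j e = <ᵇ≡true⇒< (∧≡true⁻ʳ {i ≤ᵇ j} e)

  unfilled⇒end≤ : ∀ {i j} → filledᵇ i j ≡ false → i ℕ.≤ j → i ℕ.+ r i ℕ.≤ j
  unfilled⇒end≤ unfilled i≤j =
    ℕₚ.≮⇒≥ (λ j<end → true≢false (trans (sym (filled-intro i≤j j<end)) unfilled))

  maximalᵇ-eval : ∀ i j {x y z} → filledᵇ i j ≡ x → filledᵇ (suc i) j ≡ y → filledᵇ i (suc j) ≡ z →
    maximalᵇ i j ≡ (x ∧ not y ∧ not z)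
  maximalᵇ-eval i j refl refl refl = refl

  addableᵇ-eval : ∀ i j {x y z} → filledᵇ i j ≡ x → ((i ≡ᵇ 1) ∨ filledᵇ (i ∸ 1) j) ≡ y →
    ((j ≡ᵇ i) ∨ filledᵇ i (j ∸ 1)) ≡ z → addableᵇ i j ≡ (not x ∧ y ∧ z)
  addableᵇ-eval i j refl refl refl = refl

  maximal⇒lastCell : ∀ i j → maximalᵇ i j ≡ true → j ≡ i ℕ.+ r i ∸ 1
  maximal⇒lastCell i j max = cong (_∸ 1) (ℕₚ.≤-antisym (filled⇒< i j j∈) (unfilled⇒end≤ next∉ (ℕₚ.m≤n⇒m≤1+n i≤j)))
    where
    j∈ : filledᵇ i j ≡ true
    j∈ = ∧≡true⁻ˡ max
    i≤j : i ℕ.≤ j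
    i≤j = filled⇒≤ i j j∈
    next∉ : filledᵇ i (suc j) ≡ false
    next∉ = not≡true⇒≡false (∧≡true⁻ʳ {not (filledᵇ (suc i) j)} (∧≡true⁻ʳ {filledᵇ i j} max))

  addable⇒endCell : ∀ i j → addableᵇ i j ≡ true → j ≡ i ℕ.+ r i
  addable⇒endCell i j add with ∨≡true⁻ {j ≡ᵇ i} (∧≡true⁻ʳ {(i ≡ᵇ 1) ∨ filledᵇ (i ∸ 1) j} (∧≡true⁻ʳ {not (filledᵇ i j)} add))
  ... | inj₁ j≡i with ≡ᵇ≡true⇒≡ {j} j≡i
  ...   | refl = ℕₚ.≤-antisym (ℕₚ.m≤m+n j (r j)) (unfilled⇒end≤ j∉ ℕₚ.≤-refl)
    where
    j∉ : filledᵇ j j ≡ false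
    j∉ = not≡true⇒≡false (∧≡true⁻ˡ add)
  addable⇒endCell i zero add | inj₂ prev∈ =
    ⊥-elim (true≢false (trans (sym prev∈) (not≡true⇒≡false (∧≡true⁻ˡ add))))
  addable⇒endCell i (suc j) add | inj₂ prev∈ =
    ℕₚ.≤-antisym (filled⇒< i j prev∈)
                 (unfilled⇒end≤ (not≡true⇒≡false (∧≡true⁻ˡ add)) (ℕₚ.m≤n⇒m≤1+n (filled⇒≤ i j prev∈)))

  filled-nextRow : ∀ i c d → r (suc i) ≡ d → d ℕ.≤ c → filledᵇ (suc i) (i ℕ.+ c) ≡ covered (suc c) d
  filled-nextRow i zero d _ d≤0 rewrite ℕₚ.n≤0⇒n≡0 d≤0 =
    filled-left (s≤s (ℕₚ.≤-reflexive (ℕₚ.+-identityʳ i)))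
  filled-nextRow i (suc c) zero rsi≡0 _ =
    filled-right (subst (λ m → suc i ℕ.+ m ℕ.≤ i ℕ.+ suc c) (sym rsi≡0)
                   (ℕₚ.≤-trans (ℕₚ.≤-reflexive (ℕₚ.+-identityʳ (suc i))) (ℕₚ.≤-trans (s≤s (ℕₚ.m≤m+n i c)) (ℕₚ.≤-reflexive (sym (ℕₚ.+-suc i c))))))
  filled-nextRow i (suc c) (suc d) rsi≡ d≤c with c ℕₚ.≟ d
  ... | yes refl = trans (filled-intro (ℕₚ.≤-trans (s≤s (ℕₚ.m≤m+n i c)) (ℕₚ.≤-reflexive (sym (ℕₚ.+-suc i c))))
                                       (subst (λ m → i ℕ.+ suc c ℕ.< suc i ℕ.+ m) (sym rsi≡) (ℕₚ.n<1+n (i ℕ.+ suc c))))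
                         (sym (≡⇒≡ᵇ≡true {c} refl))
  ... | no c≢d = trans (filled-right (subst (λ m → suc i ℕ.+ m ℕ.≤ i ℕ.+ suc c) (sym rsi≡)
                                      (ℕₚ.≤-trans (ℕₚ.≤-reflexive (sym (ℕₚ.+-suc i (suc d))))
                                                  (ℕₚ.+-monoʳ-≤ i (s≤s (ℕₚ.≤∧≢⇒< (ℕₚ.≤-pred d≤c) (c≢d ∘ sym)))))))
                       (sym (≢⇒≡ᵇ≡false c≢d))

  lastCell-maximal : ∀ i c d → r i ≡ c → r (suc i) ≡ d → c ℕ.≤ len i → d ℕ.≤ c ∸ 1 →
    (maximalᵇ i (i ℕ.+ c ∸ 1) ∧ (i ≤ᵇ i ℕ.+ c ∸ 1) ∧ (i ℕ.+ c ∸ 1 <ᵇ i ℕ.+ len i)) ≡ hasRemovable c d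
  lastCell-maximal i zero d ri≡0 _ _ _ =
    cong (λ x → x ∧ ((i ≤ᵇ t) ∧ (t <ᵇ i ℕ.+ len i))) (maximalᵇ-eval i t row∅ refl refl)
    where
    t = i ℕ.+ 0 ∸ 1
    row∅ : filledᵇ i t ≡ false
    row∅ = trans (cong (λ m → (i ≤ᵇ t) ∧ (t <ᵇ i ℕ.+ m)) ri≡0) (empty-rangeᵇ i t)
  lastCell-maximal i (suc c) d ri≡ rsi≡ c<len d≤c =
    subst (λ t → (maximalᵇ i t ∧ (i ≤ᵇ t) ∧ (t <ᵇ i ℕ.+ len i)) ≡ hasRemovable (suc c) d) (sym (m+[1+n]∸1≡m+n i c))
      (trans (cong₂ _∧_ (maximalᵇ-eval i (i ℕ.+ c) last∈ (filled-nextRow i c d rsi≡ d≤c) after∉)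
                        (cong₂ _∧_ (≤⇒≤ᵇ≡true (ℕₚ.m≤m+n i c)) (<⇒<ᵇ≡true (ℕₚ.+-monoʳ-< i c<len))))
             (trans (∧-identityʳ _) (∧-identityʳ _)))
    where
    last∈ : filledᵇ i (i ℕ.+ c) ≡ true
    last∈ = filled-intro (ℕₚ.m≤m+n i c) (subst (λ m → i ℕ.+ c ℕ.< i ℕ.+ m) (sym ri≡) (ℕₚ.+-monoʳ-< i (ℕₚ.n<1+n c)))
    after∉ : filledᵇ i (suc (i ℕ.+ c)) ≡ false
    after∉ = filled-right (subst (λ m → i ℕ.+ m ℕ.≤ suc (i ℕ.+ c)) (sym ri≡) (ℕₚ.≤-reflexive (ℕₚ.+-suc i c)))

  sum-maximal : ∀ i (H : ℕ → ℤ) → r i ℕ.≤ len i → r (suc i) ℕ.≤ r i ∸ 1 →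
    sumRange (λ j → 𝟙 (maximalᵇ i j) ℤ.* H j) i (len i) ≡ 𝟙 (hasRemovable (r i) (r (suc i))) ℤ.* H (i ℕ.+ r i ∸ 1)
  sum-maximal i H r≤len below =
    trans (sumRange-indicator (maximalᵇ i) H (i ℕ.+ r i ∸ 1) i (len i) (maximal⇒lastCell i))
          (cong (λ x → 𝟙 x ℤ.* H (i ℕ.+ r i ∸ 1)) (lastCell-maximal i (r i) (r (suc i)) refl refl r≤len below))

  aboveCell-filled : ∀ i c → 1 ℕ.≤ i → c ℕ.< n → ((i ≡ᵇ 1) ∨ filledᵇ (i ∸ 1) (i ℕ.+ c)) ≡ (suc c <ᵇ lengthAbove i)
  aboveCell-filled (suc zero) c _ c<n = sym (<⇒<ᵇ≡true c<n)
  aboveCell-filled (suc (suc k)) c _ _ =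
    cong₂ _∧_ (≤⇒≤ᵇ≡true (ℕₚ.≤-trans (ℕₚ.n≤1+n (suc k)) (ℕₚ.m≤m+n (suc (suc k)) c)))
              (trans (cong (_<ᵇ suc k ℕ.+ r (suc k)) (sym (ℕₚ.+-suc (suc k) c))) (+<ᵇ+ (suc k) (suc c) (r (suc k))))

  endCell-leftFilled : ∀ i c → r i ≡ c → ((i ℕ.+ c ≡ᵇ i) ∨ filledᵇ i (i ℕ.+ c ∸ 1)) ≡ true
  endCell-leftFilled i zero _ = cong (_∨ filledᵇ i (i ℕ.+ 0 ∸ 1)) (≡⇒≡ᵇ≡true (ℕₚ.+-identityʳ i))
  endCell-leftFilled i (suc c) ri≡ =
    trans (cong ((i ℕ.+ suc c ≡ᵇ i) ∨_) (subst (λ t → filledᵇ i t ≡ true) (sym (m+[1+n]∸1≡m+n i c)) last∈))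
          (∨-zeroʳ (i ℕ.+ suc c ≡ᵇ i))
    where
    last∈ : filledᵇ i (i ℕ.+ c) ≡ true
    last∈ = filled-intro (ℕₚ.m≤m+n i c) (subst (λ m → i ℕ.+ c ℕ.< i ℕ.+ m) (sym ri≡) (ℕₚ.+-monoʳ-< i (ℕₚ.n<1+n c)))

  endCell-addable : ∀ i c L → r i ≡ c → 1 ℕ.≤ i → c ℕ.< n →
    (addableᵇ i (i ℕ.+ c) ∧ (i ≤ᵇ i ℕ.+ c) ∧ (i ℕ.+ c <ᵇ i ℕ.+ L)) ≡ hasAddable L (lengthAbove i) c
  endCell-addable i c L ri≡ 1≤i c<n =
    trans (cong₂ _∧_ (addableᵇ-eval i (i ℕ.+ c) end∉ (aboveCell-filled i c 1≤i c<n) (endCell-leftFilled i c ri≡))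
                     (cong₂ _∧_ (≤⇒≤ᵇ≡true (ℕₚ.m≤m+n i c)) (+<ᵇ+ i c L)))
          (cong (_∧ (c <ᵇ L)) (∧-identityʳ (suc c <ᵇ lengthAbove i)))
    where
    end∉ : filledᵇ i (i ℕ.+ c) ≡ false
    end∉ = filled-right (ℕₚ.≤-reflexive (cong (i ℕ.+_) ri≡))

  sum-addable : ∀ i (H : ℕ → ℤ) → 1 ℕ.≤ i → r i ℕ.< n →
    sumRange (λ j → 𝟙 (addableᵇ i j) ℤ.* H j) i (len i) ≡ 𝟙 (hasAddable (len i) (lengthAbove i) (r i)) ℤ.* H (i ℕ.+ r i)
  sum-addable i H 1≤i r<n =
    trans (sumRange-indicator (addableᵇ i) H (i ℕ.+ r i) i (len i) (addable⇒endCell i))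
          (cong (λ x → 𝟙 x ℤ.* H (i ℕ.+ r i)) (endCell-addable i (r i) (len i) refl 1≤i r<n))

  diagonal-addable : ∀ i → 1 ℕ.≤ i → 0 ℕ.< n → addableᵇ i i ≡ diagonalAddable (lengthAbove i) (r i)
  diagonal-addable i 1≤i 0<n =
    trans (addableᵇ-eval i i diagonal∈ above∈ (cong (_∨ filledᵇ i (i ∸ 1)) (≡⇒≡ᵇ≡true {i} refl)))
          (cong₂ _∧_ (not[0<ᵇc]≡[c≡ᵇ0] (r i)) (∧-identityʳ (1 <ᵇ lengthAbove i)))
    where
    diagonal∈ : filledᵇ i i ≡ (0 <ᵇ r i)
    diagonal∈ = cong₂ _∧_ (≤⇒≤ᵇ≡true (ℕₚ.≤-refl {i})) (trans (cong (_<ᵇ i ℕ.+ r i) (sym (ℕₚ.+-identityʳ i))) (+<ᵇ+ i 0 (r i)))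
    above∈ : ((i ≡ᵇ 1) ∨ filledᵇ (i ∸ 1) i) ≡ (1 <ᵇ lengthAbove i)
    above∈ = subst (λ t → ((i ≡ᵇ 1) ∨ filledᵇ (i ∸ 1) t) ≡ (1 <ᵇ lengthAbove i)) (ℕₚ.+-identityʳ i) (aboveCell-filled i 0 1≤i 0<n)
    not[0<ᵇc]≡[c≡ᵇ0] : ∀ c → not (0 <ᵇ c) ≡ (c ≡ᵇ 0)
    not[0<ᵇc]≡[c≡ᵇ0] zero = refl
    not[0<ᵇc]≡[c≡ᵇ0] (suc c) = refl

  len-spec : ∀ i k → n ≡ i ℕ.+ (i ℕ.+ k) → (n ∸ i ≡ i ℕ.+ k) × (len i ≡ suc k)
  len-spec i k n≡ = n∸i≡ , trans (cong (λ m → suc m ∸ i) n∸i≡)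
                                 (trans (cong (_∸ i) (sym (ℕₚ.+-suc i k))) (ℕₚ.m+n∸m≡n i (suc k)))
    where
    n∸i≡ : n ∸ i ≡ i ℕ.+ k
    n∸i≡ = trans (cong (_∸ i) n≡) (ℕₚ.m+n∸m≡n i (i ℕ.+ k))

  lastCell-filled : ∀ i k → n ≡ i ℕ.+ (i ℕ.+ k) → r i ℕ.≤ len i → filledᵇ i (n ∸ i) ≡ (r i ≡ᵇ suc k)
  lastCell-filled i k n≡ r≤len =
    trans (cong (filledᵇ i) (proj₁ (len-spec i k n≡)))
          (trans (cong₂ _∧_ (≤⇒≤ᵇ≡true (ℕₚ.m≤m+n i k)) (+<ᵇ+ i k (r i)))
                 (below-top (subst (r i ℕ.≤_) (proj₂ (len-spec i k n≡)) r≤len)))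
    where
    below-top : r i ℕ.≤ suc k → (k <ᵇ r i) ≡ (r i ≡ᵇ suc k)
    below-top r≤ with ℕₚ.m≤n⇒m<n∨m≡n r≤
    ... | inj₂ r≡ = trans (<⇒<ᵇ≡true (ℕₚ.≤-reflexive (sym r≡))) (sym (≡⇒≡ᵇ≡true r≡))
    ... | inj₁ r< = trans (≥⇒<ᵇ≡false (ℕₚ.≤-pred r<)) (sym (≢⇒≡ᵇ≡false (ℕₚ.<⇒≢ r<)))

  lastCells-bothFull : ∀ i k → n ≡ suc i ℕ.+ (suc i ℕ.+ k) → r i ℕ.≤ len i → r (suc i) ℕ.≤ len (suc i) →
    (filledᵇ i (n ∸ i) ∧ filledᵇ (i ℕ.+ 1) (n ∸ (i ℕ.+ 1))) ≡ bothFull (len (suc i)) (r i) (r (suc i))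
  lastCells-bothFull i k n≡ r≤len r′≤len′ = begin
    filledᵇ i (n ∸ i) ∧ filledᵇ (i ℕ.+ 1) (n ∸ (i ℕ.+ 1))
      ≡⟨ cong₂ _∧_ (lastCell-filled i (suc (suc k)) n≡′ r≤len)
                   (trans (cong (λ m → filledᵇ m (n ∸ m)) (ℕₚ.+-comm i 1)) (lastCell-filled (suc i) k n≡ r′≤len′)) ⟩
    (r i ≡ᵇ suc (suc (suc k))) ∧ (r (suc i) ≡ᵇ suc k)
      ≡⟨ ∧-comm (r i ≡ᵇ suc (suc (suc k))) (r (suc i) ≡ᵇ suc k) ⟩
    (r (suc i) ≡ᵇ suc k) ∧ (r i ≡ᵇ suc (suc (suc k)))
      ≡⟨ cong (λ L → (r (suc i) ≡ᵇ L) ∧ (r i ≡ᵇ suc (suc L))) (sym (proj₂ (len-spec (suc i) k n≡))) ⟩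
    bothFull (len (suc i)) (r i) (r (suc i)) ∎
    where
    open ≡-Reasoning
    n≡′ : n ≡ i ℕ.+ (i ℕ.+ suc (suc k))
    n≡′ = trans n≡ (shuffle i k)
      where
      shuffle : ∀ i k → suc i ℕ.+ (suc i ℕ.+ k) ≡ i ℕ.+ (i ℕ.+ suc (suc k))
      shuffle = ℕ-solve-∀


pos-∸ : ∀ {m i} → i ℕ.≤ m → + (m ∸ i) ≡ + m ℤ.- + i
pos-∸ {m} {i} i≤m = sym (trans (ℤₚ.m-n≡m⊖n m i) (ℤₚ.⊖-≥ i≤m))

module ValidProfile (a b : ℕ) (r : ℕ → ℕ) (1≤a : 1 ℕ.≤ a) (a≤b : a ℕ.≤ b)
  (r≤len : ∀ i → 1 ℕ.≤ i → i ℕ.≤ a → r i ℕ.≤ Rows.len a b i)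
  (r-vanishes : r (suc a) ≡ 0)
  (r-decreasing : ∀ i → 1 ℕ.≤ i → r (suc i) ℕ.≤ r i ∸ 1) where

  open Profile a b r public

  1≤n : 1 ℕ.≤ n
  1≤n = ℕₚ.≤-trans 1≤a (ℕₚ.m≤m+n a b)

  row-split : ∀ i → i ℕ.≤ a → Σ[ k ∈ ℕ ] n ≡ i ℕ.+ (i ℕ.+ k)
  row-split i i≤a = n ∸ (i ℕ.+ i) , trans (sym (ℕₚ.m+[n∸m]≡n i+i≤n)) (ℕₚ.+-assoc i i _)
    where
    i+i≤n : i ℕ.+ i ℕ.≤ n
    i+i≤n = ℕₚ.+-mono-≤ i≤a (ℕₚ.≤-trans i≤a a≤b)

  maximalCount : ℕ → ℤ
  maximalCount i = sumRange (λ j → 𝟙 (maximalᵇ i j)) i (len i)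

  toggleWeight : ℕ → ℤ
  toggleWeight i = sumRange (λ j → w i j ℤ.* (𝟙 (addableᵇ i j) ℤ.- 𝟙 (maximalᵇ i j))) i (len i)

  diagonalTerm : ℕ → ℤ
  diagonalTerm i = + (a ∸ i) ℤ.* 𝟙 (addableᵇ i i)

  fullPairTerm : ℕ → ℤ
  fullPairTerm i = + i ℤ.* 𝟙 (filledᵇ i (n ∸ i) ∧ filledᵇ (i ℕ.+ 1) (n ∸ (i ℕ.+ 1)))

  rowTerm : ℕ → ℤ
  rowTerm i = N ℤ.* maximalCount i ℤ.+ toggleWeight i
              ℤ.- (+ a ℤ.- + b) ℤ.* diagonalTerm i ℤ.+ (+ a ℤ.- + b) ℤ.* fullPairTerm (i ∸ 1)

  Φ-above : ℕ → ℤ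
  Φ-above i = Φ (i ∸ 1) (lengthAbove i) (r i)

  len-split : ∀ i → i ℕ.≤ a → Σ[ k ∈ ℕ ] (n ≡ i ℕ.+ (i ℕ.+ k)) × (len i ≡ suc k)
  len-split i i≤a with row-split i i≤a
  ... | k , n≡ = k , n≡ , proj₂ (len-spec i k n≡)

  len<n : ∀ i → 1 ℕ.≤ i → i ℕ.≤ a → len i ℕ.< n
  len<n i 1≤i i≤a with len-split i i≤a
  ... | k , n≡ , len≡ = subst₂ ℕ._<_ (sym len≡) (sym n≡) (ℕₚ.+-mono-≤ 1≤i (ℕₚ.+-monoˡ-≤ k 1≤i))

  maximalCount≡ : ∀ i → 1 ℕ.≤ i → i ℕ.≤ a → maximalCount i ≡ 𝟙 (hasRemovable (r i) (r (suc i)))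
  maximalCount≡ i 1≤i i≤a =
    trans (sumRange-cong _ (λ j → 𝟙 (maximalᵇ i j) ℤ.* 1ℤ) i (len i) (λ j _ _ → sym (ℤₚ.*-identityʳ _)))
          (trans (sum-maximal i (λ _ → 1ℤ) (r≤len i 1≤i i≤a) (r-decreasing i 1≤i)) (ℤₚ.*-identityʳ _))

  toggleWeight≡ : ∀ i → 1 ℕ.≤ i → i ℕ.≤ a →
    toggleWeight i ≡ 𝟙 (hasAddable (len i) (lengthAbove i) (r i)) ℤ.* w i (i ℕ.+ r i)
                     ℤ.- 𝟙 (hasRemovable (r i) (r (suc i))) ℤ.* w i (i ℕ.+ r i ∸ 1)
  toggleWeight≡ i 1≤i i≤a = begin
    toggleWeight i
      ≡⟨ sumRange-cong _ _ i (len i) (λ j _ _ → distrib (w i j) (𝟙 (addableᵇ i j)) (𝟙 (maximalᵇ i j))) ⟩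
    sumRange (λ j → 𝟙 (addableᵇ i j) ℤ.* w i j ℤ.- 𝟙 (maximalᵇ i j) ℤ.* w i j) i (len i)
      ≡⟨ sumRange-- _ _ i (len i) ⟩
    sumRange (λ j → 𝟙 (addableᵇ i j) ℤ.* w i j) i (len i) ℤ.- sumRange (λ j → 𝟙 (maximalᵇ i j) ℤ.* w i j) i (len i)
      ≡⟨ cong₂ ℤ._-_ (sum-addable i (w i) 1≤i r<n) (sum-maximal i (w i) (r≤len i 1≤i i≤a) (r-decreasing i 1≤i)) ⟩
    _ ∎
    where
    open ≡-Reasoning
    r<n : r i ℕ.< n
    r<n = ℕₚ.≤-<-trans (r≤len i 1≤i i≤a) (len<n i 1≤i i≤a)
    distrib : ∀ W x y → W ℤ.* (x ℤ.- y) ≡ x ℤ.* W ℤ.- y ℤ.* W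
    distrib = solve-∀

  diagonalTerm≡ : ∀ i → 1 ℕ.≤ i → i ℕ.≤ a →
    diagonalTerm i ≡ (+ a ℤ.- + i) ℤ.* 𝟙 (diagonalAddable (lengthAbove i) (r i))
  diagonalTerm≡ i 1≤i i≤a = cong₂ ℤ._*_ (pos-∸ i≤a) (cong 𝟙 (diagonal-addable i 1≤i 1≤n))

  fullPairTerm≡ : ∀ i → 1 ℕ.≤ i → i ℕ.≤ a →
    fullPairTerm (i ∸ 1) ≡ (+ i ℤ.- 1ℤ) ℤ.* 𝟙 (bothFull (len i) (lengthAbove i) (r i))
  fullPairTerm≡ (suc zero) _ _ = refl
  fullPairTerm≡ (suc (suc k)) _ i≤a with row-split (suc (suc k)) i≤a
  ... | m , n≡ = cong (+ suc k ℤ.*_)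
                   (cong 𝟙 (lastCells-bothFull (suc k) m n≡ (r≤len (suc k) (s≤s z≤n) (ℕₚ.≤-trans (ℕₚ.n≤1+n (suc k)) i≤a))
                                                            (r≤len (suc (suc k)) (s≤s z≤n) i≤a)))

  rowTerm≡rowContribution : ∀ i → 1 ℕ.≤ i → i ℕ.≤ a →
    rowTerm i ≡ rowContribution i (len i) (lengthAbove i) (r i) (r (suc i))
  rowTerm≡rowContribution i 1≤i i≤a =
    assemble (+ a) (+ b) (+ i) (𝟙 (hasRemovable (r i) (r (suc i)))) (𝟙 (hasAddable (len i) (lengthAbove i) (r i)))
      (w i (i ℕ.+ r i)) (w i (i ℕ.+ r i ∸ 1))
      (𝟙 (diagonalAddable (lengthAbove i) (r i))) (𝟙 (bothFull (len i) (lengthAbove i) (r i)))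
      (maximalCount i) (toggleWeight i) (diagonalTerm i) (fullPairTerm (i ∸ 1))
      (maximalCount≡ i 1≤i i≤a) (toggleWeight≡ i 1≤i i≤a) (diagonalTerm≡ i 1≤i i≤a) (fullPairTerm≡ i 1≤i i≤a)
    where
    assemble : ∀ A B I R Y Wa Wr P F M T D S → M ≡ R → T ≡ Y ℤ.* Wa ℤ.- R ℤ.* Wr →
      D ≡ (A ℤ.- I) ℤ.* P → S ≡ (I ℤ.- 1ℤ) ℤ.* F →
      (A ℤ.+ B) ℤ.* M ℤ.+ T ℤ.- (A ℤ.- B) ℤ.* D ℤ.+ (A ℤ.- B) ℤ.* S
      ≡ R ℤ.* ((A ℤ.+ B) ℤ.- Wr) ℤ.+ (Y ℤ.* Wa ℤ.- (A ℤ.- B) ℤ.* ((A ℤ.- I) ℤ.* P) ℤ.+ (A ℤ.- B) ℤ.* ((I ℤ.- 1ℤ) ℤ.* F))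
    assemble A B I R Y Wa Wr P F _ _ _ _ refl refl refl refl = solve (A ∷ B ∷ I ∷ R ∷ Y ∷ Wa ∷ Wr ∷ P ∷ F ∷ [])

  rowTerm-telescopes : ∀ i → 1 ℕ.≤ i → i ℕ.≤ a → rowTerm i ≡ + b ℤ.+ (Φ-above i ℤ.- Φ-above (suc i))
  rowTerm-telescopes (suc k) 1≤i i≤a with len-split (suc k) i≤a
  ... | m , n≡ , len≡ =
    trans (rowTerm≡rowContribution (suc k) 1≤i i≤a)
          (trans (rowIdentity k (len (suc k)) (lengthAbove (suc k)) (r (suc k)) (r (suc (suc k)))
                    1≤len size (r≤len (suc k) 1≤i i≤a) (below-above k i≤a) (above-bounded k i≤a))
                 (ℤₚ.+-assoc (+ b) (Φ-above (suc k)) (ℤ.- Φ-above (suc (suc k)))))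
    where
    1≤len : 1 ℕ.≤ len (suc k)
    1≤len = subst (1 ℕ.≤_) (sym len≡) (s≤s z≤n)
    size : len (suc k) ℕ.+ 2 ℕ.* suc k ≡ suc n
    size = trans (cong (ℕ._+ 2 ℕ.* suc k) len≡) (trans (reorder (suc k) m) (cong suc (sym n≡)))
      where
      reorder : ∀ i m → suc m ℕ.+ 2 ℕ.* i ≡ suc (i ℕ.+ (i ℕ.+ m))
      reorder = ℕ-solve-∀
    below-above : ∀ k → suc k ℕ.≤ a → r (suc k) ℕ.≤ lengthAbove (suc k) ∸ 1
    below-above zero 1≤a′ = ℕₚ.≤-trans (r≤len 1 (s≤s z≤n) 1≤a′) (ℕₚ.m∸n≤m n 1)
    below-above (suc j) _ = r-decreasing (suc j) (s≤s z≤n)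
    above-bounded : ∀ k → suc k ℕ.≤ a → lengthAbove (suc k) ℕ.≤ suc (suc (len (suc k)))
    above-bounded zero _ = s≤s (ℕₚ.≤-reflexive (sym (trans (ℕₚ.+-comm 1 (n ∸ 1)) (ℕₚ.m∸n+n≡m 1≤n))))
    above-bounded (suc j) i≤a′ with len-split (suc (suc j)) i≤a′
    ... | m′ , n≡′ , len≡′ = subst (r (suc j) ℕ.≤_) (trans (proj₂ (len-spec (suc j) (suc (suc m′)) (shift j m′ n≡′))) (cong (λ l → suc (suc l)) (sym len≡′)))
                                    (r≤len (suc j) (s≤s z≤n) (ℕₚ.≤-trans (ℕₚ.n≤1+n (suc j)) i≤a′))
      where
      shift : ∀ j m → n ≡ suc (suc j) ℕ.+ (suc (suc j) ℕ.+ m) → n ≡ suc j ℕ.+ (suc j ℕ.+ suc (suc m))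
      shift j m n≡ = trans n≡ (reorder j m)
        where
        reorder : ∀ j m → suc (suc j) ℕ.+ (suc (suc j) ℕ.+ m) ≡ suc j ℕ.+ (suc j ℕ.+ suc (suc m))
        reorder = ℕ-solve-∀

  Φ-above-first : Φ-above 1 ≡ 0ℤ
  Φ-above-first rewrite ≢⇒≡ᵇ≡false {n} {r 1} (ℕₚ.>⇒≢ (ℕₚ.≤-<-trans (r≤len 1 (s≤s z≤n) 1≤a) (len<n 1 (s≤s z≤n) 1≤a)))
                | ∧-zeroʳ (0 <ᵇ r 1) | ≥⇒<ᵇ≡false 1≤n = refl

  Φ-above-last : Φ-above (suc a) ≡ 0ℤ
  Φ-above-last rewrite r-vanishes = vanish (𝟙 (lengthAbove (suc a) ≤ᵇ 1)) (+ a) (+ b) (N ℤ.- w a (a ℕ.+ lengthAbove (suc a) ∸ 1))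
    where
    vanish : ∀ X A B M → 0ℤ ℤ.* M ℤ.- X ℤ.* ((A ℤ.- A) ℤ.* B) ≡ 0ℤ
    vanish = solve-∀

  sum-rowTerm : sumRange rowTerm 1 a ≡ + (a ℕ.* b)
  sum-rowTerm = begin
    sumRange rowTerm 1 a
      ≡⟨ sumRange-cong _ _ 1 a (λ i 1≤i i<1+a → rowTerm-telescopes i 1≤i (ℕₚ.≤-pred i<1+a)) ⟩
    sumRange (λ i → + b ℤ.+ (Φ-above i ℤ.- Φ-above (suc i))) 1 a
      ≡⟨ sumRange-+ (λ _ → + b) (λ i → Φ-above i ℤ.- Φ-above (suc i)) 1 a ⟩
    sumRange (λ _ → + b) 1 a ℤ.+ sumRange (λ i → Φ-above i ℤ.- Φ-above (suc i)) 1 a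
      ≡⟨ cong₂ ℤ._+_ (sumRange-const (+ b) 1 a) (sumRange-telescope Φ-above 1 a) ⟩
    + a ℤ.* + b ℤ.+ (Φ-above 1 ℤ.- Φ-above (suc a))
      ≡⟨ cong₂ (λ x y → + a ℤ.* + b ℤ.+ (x ℤ.- y)) Φ-above-first Φ-above-last ⟩
    + a ℤ.* + b ℤ.+ 0ℤ
      ≡⟨ trans (ℤₚ.+-identityʳ _) (sym (ℤₚ.pos-* a b)) ⟩
    + (a ℕ.* b) ∎
    where open ≡-Reasoning

  sum-rowTerm-split : sumRange rowTerm 1 a ≡
    N ℤ.* sumRange maximalCount 1 a ℤ.+ sumRange toggleWeight 1 a
    ℤ.- (+ a ℤ.- + b) ℤ.* sumRange diagonalTerm 1 a ℤ.+ (+ a ℤ.- + b) ℤ.* sumRange fullPairTerm 1 (a ∸ 1)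
  sum-rowTerm-split = begin
    sumRange rowTerm 1 a
      ≡⟨ sumRange-+ (λ i → N ℤ.* M i ℤ.+ W i ℤ.- AB ℤ.* D i) (λ i → AB ℤ.* F (i ∸ 1)) 1 a ⟩
    sumRange (λ i → N ℤ.* M i ℤ.+ W i ℤ.- AB ℤ.* D i) 1 a ℤ.+ sumRange (λ i → AB ℤ.* F (i ∸ 1)) 1 a
      ≡⟨ cong₂ ℤ._+_ (sumRange-- (λ i → N ℤ.* M i ℤ.+ W i) (λ i → AB ℤ.* D i) 1 a)
                     (trans (sumRange-* AB (λ i → F (i ∸ 1)) 1 a) (cong (AB ℤ.*_) (sumRange-pred F a refl))) ⟩
    sumRange (λ i → N ℤ.* M i ℤ.+ W i) 1 a ℤ.- sumRange (λ i → AB ℤ.* D i) 1 a ℤ.+ AB ℤ.* sumRange F 1 (a ∸ 1)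
      ≡⟨ cong₂ (λ x y → x ℤ.- y ℤ.+ AB ℤ.* sumRange F 1 (a ∸ 1))
               (trans (sumRange-+ (λ i → N ℤ.* M i) W 1 a) (cong (ℤ._+ sumRange W 1 a) (sumRange-* N M 1 a)))
               (sumRange-* AB D 1 a) ⟩
    N ℤ.* sumRange M 1 a ℤ.+ sumRange W 1 a ℤ.- AB ℤ.* sumRange D 1 a ℤ.+ AB ℤ.* sumRange F 1 (a ∸ 1) ∎
    where
    open ≡-Reasoning
    M = maximalCount
    W = toggleWeight
    D = diagonalTerm
    F = fullPairTerm
    AB = + a ℤ.- + b

  profileIdentity : N ℤ.* sumRange maximalCount 1 a ℤ.+ sumRange toggleWeight 1 a
    ≡ + (a ℕ.* b) ℤ.+ (+ a ℤ.- + b) ℤ.* (sumRange diagonalTerm 1 a ℤ.- sumRange fullPairTerm 1 (a ∸ 1))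
  profileIdentity = begin
    X                                                   ≡⟨ regroup X AB S₁ S₂ ⟩
    (X ℤ.- AB ℤ.* S₁ ℤ.+ AB ℤ.* S₂) ℤ.+ AB ℤ.* (S₁ ℤ.- S₂) ≡⟨ cong (ℤ._+ AB ℤ.* (S₁ ℤ.- S₂)) (trans (sym sum-rowTerm-split) sum-rowTerm) ⟩
    + (a ℕ.* b) ℤ.+ AB ℤ.* (S₁ ℤ.- S₂)                  ∎
    where
    open ≡-Reasoning
    X = N ℤ.* sumRange maximalCount 1 a ℤ.+ sumRange toggleWeight 1 a
    AB = + a ℤ.- + b
    S₁ = sumRange diagonalTerm 1 a
    S₂ = sumRange fullPairTerm 1 (a ∸ 1)
    regroup : ∀ X AB S₁ S₂ → X ≡ (X ℤ.- AB ℤ.* S₁ ℤ.+ AB ℤ.* S₂) ℤ.+ AB ℤ.* (S₁ ℤ.- S₂)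
    regroup = solve-∀


-- Lists and the cells of 𝒯(a,b)

eqᵇ-refl : ∀ p → eqᵇ p p ≡ true
eqᵇ-refl (i , j) rewrite ≡⇒≡ᵇ≡true {i} refl | ≡⇒≡ᵇ≡true {j} refl = refl

eqᵇ⇒≡ : ∀ p q → eqᵇ p q ≡ true → p ≡ q
eqᵇ⇒≡ (i , j) (k , l) e = cong₂ _,_ (≡ᵇ≡true⇒≡ (∧≡true⁻ˡ e)) (≡ᵇ≡true⇒≡ (∧≡true⁻ʳ {i ≡ᵇ k} e))

≢⇒eqᵇ≡false : ∀ p q → p ≢ q → eqᵇ p q ≡ false
≢⇒eqᵇ≡false p q p≢q = ¬-not (λ e → p≢q (eqᵇ⇒≡ p q e))

memᵇ-here : ∀ p L → memᵇ p (p ∷ L) ≡ true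
memᵇ-here p L rewrite eqᵇ-refl p = refl

memᵇ-there : ∀ p q L → memᵇ p L ≡ true → memᵇ p (q ∷ L) ≡ true
memᵇ-there p q L p∈L rewrite p∈L = ∨-zeroʳ (eqᵇ p q)

memᵇ-∷⁻ : ∀ p q L → memᵇ p (q ∷ L) ≡ true → (p ≡ q) ⊎ (memᵇ p L ≡ true)
memᵇ-∷⁻ p q L p∈ with ∨≡true⁻ {eqᵇ p q} p∈
... | inj₁ p≡q = inj₁ (eqᵇ⇒≡ p q p≡q)
... | inj₂ p∈L = inj₂ p∈L

memᵇ-++ : ∀ p xs ys → memᵇ p (xs ++ ys) ≡ (memᵇ p xs ∨ memᵇ p ys)
memᵇ-++ p [] ys = refl
memᵇ-++ p (x ∷ xs) ys rewrite memᵇ-++ p xs ys = sym (∨-assoc (eqᵇ p x) (memᵇ p xs) (memᵇ p ys))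

memᵇ-false : ∀ p L → (∀ q → memᵇ q L ≡ true → p ≢ q) → memᵇ p L ≡ false
memᵇ-false p L absent with memᵇ p L in p∈L
... | false = refl
... | true = ⊥-elim (absent p p∈L refl)

memᵇ-filter : ∀ (f : Elem → Bool) L q → memᵇ q (filterᵇ f L) ≡ (memᵇ q L ∧ f q)
memᵇ-filter f [] q = refl
memᵇ-filter f (x ∷ L) q with f x in fx
... | true = kept (eqᵇ q x) refl
  where
  kept : ∀ t → eqᵇ q x ≡ t → (t ∨ memᵇ q (filterᵇ f L)) ≡ ((t ∨ memᵇ q L) ∧ f q)
  kept true q≟x = sym (trans (cong f (eqᵇ⇒≡ q x q≟x)) fx)
  kept false _ = memᵇ-filter f L q
... | false = dropped (eqᵇ q x) refl
  where
  dropped : ∀ t → eqᵇ q x ≡ t → memᵇ q (filterᵇ f L) ≡ ((t ∨ memᵇ q L) ∧ f q)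
  dropped true q≟x = trans (memᵇ-filter f L q) (trans (cong (memᵇ q L ∧_) fq) (trans (∧-zeroʳ _) (sym fq)))
    where
    fq : f q ≡ false
    fq = trans (cong f (eqᵇ⇒≡ q x q≟x)) fx
  dropped false _ = memᵇ-filter f L q

all≡true⁻ : ∀ (f : Elem → Bool) L → all f L ≡ true → ∀ p → memᵇ p L ≡ true → f p ≡ true
all≡true⁻ f (q ∷ L) all-f p p∈ with memᵇ-∷⁻ p q L p∈
... | inj₁ refl = ∧≡true⁻ˡ all-f
... | inj₂ p∈L = all≡true⁻ f L (∧≡true⁻ʳ {f q} all-f) p p∈L

all≡true⁺ : ∀ (f : Elem → Bool) L → (∀ p → memᵇ p L ≡ true → f p ≡ true) → all f L ≡ true
all≡true⁺ f [] _ = refl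
all≡true⁺ f (q ∷ L) f-on = ∧≡true⁺ (f-on q (memᵇ-here q L)) (all≡true⁺ f L (λ p p∈ → f-on p (memᵇ-there p q L p∈)))

map-applyUpTo : ∀ {A B : Set} (g : A → B) (f : ℕ → A) k → map g (applyUpTo f k) ≡ applyUpTo (g ∘ f) k
map-applyUpTo g f zero = refl
map-applyUpTo g f (suc k) = cong (g (f 0) ∷_) (map-applyUpTo g (f ∘ suc) k)

applyUpTo-cong : ∀ {A : Set} {f g : ℕ → A} → (∀ t → f t ≡ g t) → ∀ k → applyUpTo f k ≡ applyUpTo g k
applyUpTo-cong f≗g zero = refl
applyUpTo-cong f≗g (suc k) = cong₂ _∷_ (f≗g 0) (applyUpTo-cong (f≗g ∘ suc) k)

range-suc : ∀ lo k → range lo (suc k) ≡ lo ∷ range (suc lo) k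
range-suc lo k = cong₂ _∷_ (ℕₚ.+-identityʳ lo) (begin
  map (lo ℕ.+_) (applyUpTo suc k)      ≡⟨ map-applyUpTo (lo ℕ.+_) suc k ⟩
  applyUpTo (λ t → lo ℕ.+ suc t) k     ≡⟨ applyUpTo-cong (ℕₚ.+-suc lo) k ⟩
  applyUpTo (suc lo ℕ.+_) k            ≡⟨ sym (map-applyUpTo (suc lo ℕ.+_) (λ t → t) k) ⟩
  range (suc lo) k                     ∎)
  where open ≡-Reasoning

sumℤ : List ℤ → ℤ
sumℤ = foldr ℤ._+_ 0ℤ

sumℤ-++ : ∀ xs ys → sumℤ (xs ++ ys) ≡ sumℤ xs ℤ.+ sumℤ ys
sumℤ-++ [] ys = sym (ℤₚ.+-identityˡ _)
sumℤ-++ (x ∷ xs) ys rewrite sumℤ-++ xs ys = sym (ℤₚ.+-assoc x (sumℤ xs) (sumℤ ys))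

sumℤ-range : ∀ (f : ℕ → ℤ) lo k → sumℤ (map f (range lo k)) ≡ sumRange f lo k
sumℤ-range f lo zero = refl
sumℤ-range f lo (suc k) =
  trans (cong (sumℤ ∘ map f) (range-suc lo k)) (cong (λ s → f lo ℤ.+ s) (sumℤ-range f (suc lo) k))

sumℤ-concatMap-range : ∀ {A : Set} (h : A → ℤ) (F : ℕ → List A) lo k →
  sumℤ (map h (concatMap F (range lo k))) ≡ sumRange (λ i → sumℤ (map h (F i))) lo k
sumℤ-concatMap-range h F lo zero = refl
sumℤ-concatMap-range h F lo (suc k) =
  trans (cong (sumℤ ∘ map h ∘ concatMap F) (range-suc lo k)) (
  trans (cong sumℤ (map-++ h (F lo) (concatMap F (range (suc lo) k))))
        (trans (sumℤ-++ (map h (F lo)) (map h (concatMap F (range (suc lo) k))))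
               (cong (λ s → sumℤ (map h (F lo)) ℤ.+ s) (sumℤ-concatMap-range h F (suc lo) k))))

sumℤ-cong : ∀ (f g : Elem → ℤ) L → (∀ p → memᵇ p L ≡ true → f p ≡ g p) → sumℤ (map f L) ≡ sumℤ (map g L)
sumℤ-cong f g [] _ = refl
sumℤ-cong f g (p ∷ L) f≗g = cong₂ ℤ._+_ (f≗g p (memᵇ-here p L)) (sumℤ-cong f g L (λ q q∈ → f≗g q (memᵇ-there q p L q∈)))

count≡sumℤ : ∀ (f : Elem → Bool) L → + length (filterᵇ f L) ≡ sumℤ (map (𝟙 ∘ f) L)
count≡sumℤ f [] = refl
count≡sumℤ f (x ∷ L) with f x
... | true = trans (ℤₚ.pos-+ 1 (length (filterᵇ f L))) (cong (λ s → 1ℤ ℤ.+ s) (count≡sumℤ f L))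
... | false = trans (count≡sumℤ f L) (sym (ℤₚ.+-identityˡ _))

Uniqueᵇ : List Elem → Set
Uniqueᵇ [] = ⊤
Uniqueᵇ (x ∷ xs) = (memᵇ x xs ≡ false) × Uniqueᵇ xs

⊆-memᵇ : ∀ {xs ys} → xs ⊆ ys → ∀ p → memᵇ p xs ≡ true → memᵇ p ys ≡ true
⊆-memᵇ {ys = y ∷ ys} (.y ∷ʳ xs⊆ys) p p∈ = memᵇ-there p y ys (⊆-memᵇ xs⊆ys p p∈)
⊆-memᵇ {x ∷ xs} {.x ∷ ys} (refl Sublist.∷ xs⊆ys) p p∈ with memᵇ-∷⁻ p x xs p∈
... | inj₁ refl = memᵇ-here p ys
... | inj₂ p∈xs = memᵇ-there p x ys (⊆-memᵇ xs⊆ys p p∈xs)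

sumℤ-⊆ : ∀ {I L} → I ⊆ L → Uniqueᵇ L → ∀ (P : Elem → Bool) →
  sumℤ (map (𝟙 ∘ P) I) ≡ sumℤ (map (λ p → 𝟙 (memᵇ p I ∧ P p)) L)
sumℤ-⊆ Sublist.[] _ P = refl
sumℤ-⊆ {I} (y ∷ʳ I⊆L) (y∉L , uniq) P = trans (sumℤ-⊆ I⊆L uniq P) (sym (trans (cong (λ m → 𝟙 (m ∧ P y) ℤ.+ _) y∉I) (ℤₚ.+-identityˡ _)))
  where
  y∉I : memᵇ y I ≡ false
  y∉I = memᵇ-false y I (λ q q∈I y≡q → true≢false (trans (sym (⊆-memᵇ I⊆L y (subst (λ z → memᵇ z I ≡ true) (sym y≡q) q∈I))) y∉L))
sumℤ-⊆ {y ∷ I} {.y ∷ L} (refl Sublist.∷ I⊆L) (y∉L , uniq) P =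
  cong₂ ℤ._+_ (cong (λ m → 𝟙 (m ∧ P y)) (sym (memᵇ-here y I)))
              (trans (sumℤ-⊆ I⊆L uniq P) (sumℤ-cong _ _ L (λ p p∈L → cong (λ m → 𝟙 (m ∧ P p)) (sym (cong (_∨ memᵇ p I) (p≢y p p∈L))))))
  where
  p≢y : ∀ p → memᵇ p L ≡ true → eqᵇ p y ≡ false
  p≢y p p∈L = ≢⇒eqᵇ≡false p y (λ { refl → true≢false (trans (sym p∈L) y∉L) })


empty-range⇒⊥ : ∀ {lo i} → lo ℕ.≤ i → i ℕ.< lo ℕ.+ 0 → ⊥
empty-range⇒⊥ {lo} lo≤i i<lo = ℕₚ.<-irrefl refl (ℕₚ.<-≤-trans i<lo (ℕₚ.≤-trans (ℕₚ.≤-reflexive (ℕₚ.+-identityʳ lo)) lo≤i))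

memᵇ-concatMap-range⁺ : ∀ p (F : ℕ → List Elem) lo k i → lo ℕ.≤ i → i ℕ.< lo ℕ.+ k → memᵇ p (F i) ≡ true →
  memᵇ p (concatMap F (range lo k)) ≡ true
memᵇ-concatMap-range⁺ p F lo zero i lo≤i i<hi _ = ⊥-elim (empty-range⇒⊥ lo≤i i<hi)
memᵇ-concatMap-range⁺ p F lo (suc k) i lo≤i i<hi p∈ =
  subst (λ L → memᵇ p (concatMap F L) ≡ true) (sym (range-suc lo k))
    (trans (memᵇ-++ p (F lo) (concatMap F (range (suc lo) k))) (here-or-later (lo ℕₚ.≟ i)))
  where
  here-or-later : Dec (lo ≡ i) → (memᵇ p (F lo) ∨ memᵇ p (concatMap F (range (suc lo) k))) ≡ true
  here-or-later (yes refl) rewrite p∈ = refl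
  here-or-later (no lo≢i) rewrite memᵇ-concatMap-range⁺ p F (suc lo) k i (ℕₚ.≤∧≢⇒< lo≤i lo≢i) (subst (i ℕ.<_) (ℕₚ.+-suc lo k) i<hi) p∈ =
    ∨-zeroʳ (memᵇ p (F lo))

memᵇ-concatMap-range⁻ : ∀ p (F : ℕ → List Elem) lo k → memᵇ p (concatMap F (range lo k)) ≡ true →
  Σ[ i ∈ ℕ ] (lo ℕ.≤ i) × (i ℕ.< lo ℕ.+ k) × (memᵇ p (F i) ≡ true)
memᵇ-concatMap-range⁻ p F lo (suc k) p∈
  with ∨≡true⁻ {memᵇ p (F lo)} (trans (sym (memᵇ-++ p (F lo) (concatMap F (range (suc lo) k))))
                                      (subst (λ L → memᵇ p (concatMap F L) ≡ true) (range-suc lo k) p∈))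
... | inj₁ p∈F = lo , ℕₚ.≤-refl , ℕₚ.m<m+n lo (s≤s z≤n) , p∈F
... | inj₂ p∈rest with memᵇ-concatMap-range⁻ p F (suc lo) k p∈rest
...   | i , lo<i , i<hi , p∈F = i , ℕₚ.<⇒≤ lo<i , subst (i ℕ.<_) (sym (ℕₚ.+-suc lo k)) i<hi , p∈F

memᵇ-map-range⁺ : ∀ (g : ℕ → Elem) lo k j → lo ℕ.≤ j → j ℕ.< lo ℕ.+ k → memᵇ (g j) (map g (range lo k)) ≡ true
memᵇ-map-range⁺ g lo zero j lo≤j j<hi = ⊥-elim (empty-range⇒⊥ lo≤j j<hi)
memᵇ-map-range⁺ g lo (suc k) j lo≤j j<hi =
  subst (λ L → memᵇ (g j) (map g L) ≡ true) (sym (range-suc lo k)) (here-or-later (lo ℕₚ.≟ j))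
  where
  here-or-later : Dec (lo ≡ j) → memᵇ (g j) (g lo ∷ map g (range (suc lo) k)) ≡ true
  here-or-later (yes refl) = memᵇ-here (g lo) (map g (range (suc lo) k))
  here-or-later (no lo≢j) = memᵇ-there (g j) (g lo) (map g (range (suc lo) k))
    (memᵇ-map-range⁺ g (suc lo) k j (ℕₚ.≤∧≢⇒< lo≤j lo≢j) (subst (j ℕ.<_) (ℕₚ.+-suc lo k) j<hi))

memᵇ-map-range⁻ : ∀ (g : ℕ → Elem) lo k p → memᵇ p (map g (range lo k)) ≡ true →
  Σ[ j ∈ ℕ ] (lo ℕ.≤ j) × (j ℕ.< lo ℕ.+ k) × (p ≡ g j)
memᵇ-map-range⁻ g lo (suc k) p p∈
  with memᵇ-∷⁻ p (g lo) (map g (range (suc lo) k)) (subst (λ L → memᵇ p (map g L) ≡ true) (range-suc lo k) p∈)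
... | inj₁ p≡ = lo , ℕₚ.≤-refl , ℕₚ.m<m+n lo (s≤s z≤n) , p≡
... | inj₂ p∈rest with memᵇ-map-range⁻ g (suc lo) k p p∈rest
...   | j , lo<j , j<hi , p≡ = j , ℕₚ.<⇒≤ lo<j , subst (j ℕ.<_) (sym (ℕₚ.+-suc lo k)) j<hi , p≡

Uniqueᵇ-++ : ∀ xs ys → Uniqueᵇ xs → Uniqueᵇ ys → (∀ p → memᵇ p xs ≡ true → memᵇ p ys ≡ false) → Uniqueᵇ (xs ++ ys)
Uniqueᵇ-++ [] ys _ uniq-ys _ = uniq-ys
Uniqueᵇ-++ (x ∷ xs) ys (x∉xs , uniq-xs) uniq-ys disjoint =
  trans (memᵇ-++ x xs ys) (trans (cong (_∨ memᵇ x ys) x∉xs) (disjoint x (memᵇ-here x xs))) ,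
  Uniqueᵇ-++ xs ys uniq-xs uniq-ys (λ p p∈ → disjoint p (memᵇ-there p x xs p∈))

Uniqueᵇ-map-range : ∀ (g : ℕ → Elem) → (∀ {x y} → g x ≡ g y → x ≡ y) → ∀ lo k → Uniqueᵇ (map g (range lo k))
Uniqueᵇ-map-range g g-injective lo zero = tt
Uniqueᵇ-map-range g g-injective lo (suc k) = subst (Uniqueᵇ ∘ map g) (sym (range-suc lo k))
  (memᵇ-false (g lo) (map g (range (suc lo) k)) later≢ , Uniqueᵇ-map-range g g-injective (suc lo) k)
  where
  later≢ : ∀ q → memᵇ q (map g (range (suc lo) k)) ≡ true → g lo ≢ q
  later≢ q q∈ glo≡q with memᵇ-map-range⁻ g (suc lo) k q q∈
  ... | j , lo<j , _ , q≡gj = ℕₚ.<⇒≢ lo<j (g-injective (trans glo≡q q≡gj))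

Uniqueᵇ-concatMap-range : ∀ (F : ℕ → List Elem) (key : Elem → ℕ) → (∀ i p → memᵇ p (F i) ≡ true → key p ≡ i) →
  (∀ i → Uniqueᵇ (F i)) → ∀ lo k → Uniqueᵇ (concatMap F (range lo k))
Uniqueᵇ-concatMap-range F key keyed uniq lo zero = tt
Uniqueᵇ-concatMap-range F key keyed uniq lo (suc k) = subst (Uniqueᵇ ∘ concatMap F) (sym (range-suc lo k))
  (Uniqueᵇ-++ (F lo) (concatMap F (range (suc lo) k)) (uniq lo) (Uniqueᵇ-concatMap-range F key keyed uniq (suc lo) k) disjoint)
  where
  disjoint : ∀ p → memᵇ p (F lo) ≡ true → memᵇ p (concatMap F (range (suc lo) k)) ≡ false
  disjoint p p∈F = memᵇ-false p (concatMap F (range (suc lo) k)) later≢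
    where
    later≢ : ∀ q → memᵇ q (concatMap F (range (suc lo) k)) ≡ true → p ≢ q
    later≢ q q∈ refl with memᵇ-concatMap-range⁻ p F (suc lo) k q∈
    ... | i , lo<i , _ , p∈Fi = ℕₚ.<⇒≢ lo<i (trans (sym (keyed lo p p∈F)) (keyed i p p∈Fi))

module Triangle (a b : ℕ) where

  open Rows a b using (n; len)

  row : ℕ → List Elem
  row i = map (i ,_) (range i (len i))

  sumℤ-elems : ∀ (h : Elem → ℤ) →
    sumℤ (map h (elems a b)) ≡ sumRange (λ i → sumRange (λ j → h (i , j)) i (len i)) 1 a
  sumℤ-elems h = trans (sumℤ-concatMap-range h row 1 a) (sumRange-cong _ _ 1 a (λ i _ _ →
    trans (cong sumℤ (sym (map-∘ (range i (len i))))) (sumℤ-range (λ j → h (i , j)) i (len i))))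

  record InT (i j : ℕ) : Set where
    field
      1≤i : 1 ℕ.≤ i
      i≤a : i ℕ.≤ a
      i≤j : i ℕ.≤ j
      j≤n∸i : j ℕ.≤ n ∸ i

  inTᵇ⁺ : ∀ {i j} → InT i j → inTᵇ a b (i , j) ≡ true
  inTᵇ⁺ t rewrite ≤⇒≤ᵇ≡true (InT.1≤i t) | ≤⇒≤ᵇ≡true (InT.i≤a t) | ≤⇒≤ᵇ≡true (InT.i≤j t) | ≤⇒≤ᵇ≡true (InT.j≤n∸i t) = refl

  inTᵇ⁻ : ∀ i j → inTᵇ a b (i , j) ≡ true → InT i j
  inTᵇ⁻ i j e = record
    { 1≤i = ≤ᵇ≡true⇒≤ (∧≡true⁻ˡ e)
    ; i≤a = ≤ᵇ≡true⇒≤ (∧≡true⁻ˡ (∧≡true⁻ʳ {1 ≤ᵇ i} e))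
    ; i≤j = ≤ᵇ≡true⇒≤ (∧≡true⁻ˡ (∧≡true⁻ʳ {i ≤ᵇ a} (∧≡true⁻ʳ {1 ≤ᵇ i} e)))
    ; j≤n∸i = ≤ᵇ≡true⇒≤ (∧≡true⁻ʳ {i ≤ᵇ j} (∧≡true⁻ʳ {i ≤ᵇ a} (∧≡true⁻ʳ {1 ≤ᵇ i} e)))
    }

  inRow⇒≤n∸i : ∀ i j → i ℕ.≤ j → j ℕ.< i ℕ.+ len i → j ℕ.≤ n ∸ i
  inRow⇒≤n∸i i j i≤j j<end with i ℕₚ.≤? suc (n ∸ i)
  ... | yes i≤ = ℕₚ.≤-pred (subst (j ℕ.<_) (ℕₚ.m+[n∸m]≡n i≤) j<end)
  ... | no i≰ = ⊥-elim (ℕₚ.<-irrefl refl (ℕₚ.<-≤-trans j<end (ℕₚ.≤-trans (ℕₚ.≤-reflexive empty) i≤j)))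
    where
    empty : i ℕ.+ len i ≡ i
    empty = trans (cong (i ℕ.+_) (ℕₚ.m≤n⇒m∸n≡0 (ℕₚ.<⇒≤ (ℕₚ.≰⇒> i≰)))) (ℕₚ.+-identityʳ i)

  InT⇒inRow : ∀ {i j} → InT i j → j ℕ.< i ℕ.+ len i
  InT⇒inRow {i} {j} t =
    subst (j ℕ.<_) (sym (ℕₚ.m+[n∸m]≡n (ℕₚ.≤-trans (InT.i≤j t) (ℕₚ.m≤n⇒m≤1+n (InT.j≤n∸i t))))) (s≤s (InT.j≤n∸i t))

  inTᵇ⇒∈elems : ∀ p → inTᵇ a b p ≡ true → memᵇ p (elems a b) ≡ true
  inTᵇ⇒∈elems (i , j) p∈T = memᵇ-concatMap-range⁺ (i , j) row 1 a i (InT.1≤i t) (s≤s (InT.i≤a t))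
    (memᵇ-map-range⁺ (i ,_) i (len i) j (InT.i≤j t) (InT⇒inRow t))
    where t = inTᵇ⁻ i j p∈T

  ∈elems⇒inTᵇ : ∀ p → memᵇ p (elems a b) ≡ true → inTᵇ a b p ≡ true
  ∈elems⇒inTᵇ p p∈ with memᵇ-concatMap-range⁻ p row 1 a p∈
  ... | i , 1≤i , i<1+a , p∈row with memᵇ-map-range⁻ (i ,_) i (len i) p p∈row
  ...   | j , i≤j , j<end , refl = inTᵇ⁺ (record { 1≤i = 1≤i ; i≤a = ℕₚ.≤-pred i<1+a ; i≤j = i≤j ; j≤n∸i = inRow⇒≤n∸i i j i≤j j<end })

  uniqueᵇ-elems : Uniqueᵇ (elems a b)
  uniqueᵇ-elems = Uniqueᵇ-concatMap-range row proj₁ row-keyed (λ i → Uniqueᵇ-map-range (i ,_) (cong proj₂) i (len i)) 1 a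
    where
    row-keyed : ∀ i p → memᵇ p (row i) ≡ true → proj₁ p ≡ i
    row-keyed i p p∈ with memᵇ-map-range⁻ (i ,_) i (len i) p p∈
    ... | _ , _ , _ , refl = refl


-- Order ideals as row-length profiles

leqᵇ⁺ : ∀ {i j k l} → i ℕ.≤ k → j ℕ.≤ l → leqᵇ (i , j) (k , l) ≡ true
leqᵇ⁺ i≤k j≤l rewrite ≤⇒≤ᵇ≡true i≤k | ≤⇒≤ᵇ≡true j≤l = refl

leqᵇ⁻ : ∀ i j k l → leqᵇ (i , j) (k , l) ≡ true → (i ℕ.≤ k) × (j ℕ.≤ l)
leqᵇ⁻ i j k l e = ≤ᵇ≡true⇒≤ (∧≡true⁻ˡ e) , ≤ᵇ≡true⇒≤ (∧≡true⁻ʳ {i ≤ᵇ k} e)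

ltᵇ-irrefl : ∀ p → ltᵇ p p ≡ false
ltᵇ-irrefl p = trans (cong (λ e → leqᵇ p p ∧ not e) (eqᵇ-refl p)) (∧-zeroʳ (leqᵇ p p))

ltᵇ⇒leqᵇ : ∀ p q → ltᵇ p q ≡ true → leqᵇ p q ≡ true
ltᵇ⇒leqᵇ p q = ∧≡true⁻ˡ

ltᵇ-nextRow : ∀ i j → ltᵇ (i , j) (suc i , j) ≡ true
ltᵇ-nextRow i j rewrite ≤⇒≤ᵇ≡true (ℕₚ.n≤1+n i) | ≤⇒≤ᵇ≡true (ℕₚ.≤-refl {j}) | ≢⇒≡ᵇ≡false (ℕₚ.<⇒≢ (ℕₚ.n<1+n i)) = refl

ltᵇ-nextColumn : ∀ i j → ltᵇ (i , j) (i , suc j) ≡ true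
ltᵇ-nextColumn i j rewrite ≤⇒≤ᵇ≡true (ℕₚ.≤-refl {i}) | ≤⇒≤ᵇ≡true (ℕₚ.n≤1+n j) | ≡⇒≡ᵇ≡true {i} refl
                         | ≢⇒≡ᵇ≡false (ℕₚ.<⇒≢ (ℕₚ.n<1+n j)) = refl

module Ideals (a b : ℕ) where

  open Triangle a b public
  open Rows a b using (n; len)

  isIdealᵇ⁺ : ∀ S → (∀ p → memᵇ p S ≡ true → inTᵇ a b p ≡ true) →
    (∀ p q → memᵇ p S ≡ true → inTᵇ a b q ≡ true → leqᵇ q p ≡ true → memᵇ q S ≡ true) → isIdealᵇ a b S ≡ true
  isIdealᵇ⁺ S sound closed = ∧≡true⁺ (all≡true⁺ (inTᵇ a b) S sound)
    (all≡true⁺ _ S (λ p p∈ → all≡true⁺ _ (elems a b) (λ q q∈ → below p p∈ q (∈elems⇒inTᵇ q q∈))))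
    where
    below : ∀ p → memᵇ p S ≡ true → ∀ q → inTᵇ a b q ≡ true → (not (leqᵇ q p) ∨ memᵇ q S) ≡ true
    below p p∈ q q∈T with leqᵇ q p in q≤p
    ... | false = refl
    ... | true = closed p q p∈ q∈T q≤p

  isIdealᵇ⇒⊆T : ∀ S → isIdealᵇ a b S ≡ true → ∀ p → memᵇ p S ≡ true → inTᵇ a b p ≡ true
  isIdealᵇ⇒⊆T S S-ideal = all≡true⁻ (inTᵇ a b) S (∧≡true⁻ˡ S-ideal)

  isIdealᵇ⇒downClosed : ∀ S → isIdealᵇ a b S ≡ true →
    ∀ p q → memᵇ p S ≡ true → inTᵇ a b q ≡ true → leqᵇ q p ≡ true → memᵇ q S ≡ true
  isIdealᵇ⇒downClosed S S-ideal p q p∈ q∈T q≤p = subst (λ x → (not x ∨ memᵇ q S) ≡ true) q≤p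
    (all≡true⁻ _ (elems a b) (all≡true⁻ _ S (∧≡true⁻ʳ {all (inTᵇ a b) S} S-ideal) p p∈) q (inTᵇ⇒∈elems q q∈T))

  memᵇ-removeAll : ∀ A I q → memᵇ q (removeAll A I) ≡ (memᵇ q I ∧ not (memᵇ q A))
  memᵇ-removeAll A I q = memᵇ-filter (λ p → not (memᵇ p A)) I q

  module Ideal (I : List Elem) (I-ideal : isIdealᵇ a b I ≡ true) where

    ⊆T : ∀ p → memᵇ p I ≡ true → inTᵇ a b p ≡ true
    ⊆T = isIdealᵇ⇒⊆T I I-ideal

    downClosed : ∀ p q → memᵇ p I ≡ true → inTᵇ a b q ≡ true → leqᵇ q p ≡ true → memᵇ q I ≡ true
    downClosed = isIdealᵇ⇒downClosed I I-ideal

    InT-of : ∀ i j → memᵇ (i , j) I ≡ true → InT i j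
    InT-of i j p∈ = inTᵇ⁻ i j (⊆T (i , j) p∈)

    nothingAbove : ∀ i j → memᵇ (i , j) I ≡ true → memᵇ (suc i , j) I ≡ false → memᵇ (i , suc j) I ≡ false →
      ∀ k l → memᵇ (k , l) I ≡ true → leqᵇ (i , j) (k , l) ≡ true → (k , l) ≡ (i , j)
    nothingAbove i j p∈ up∉ right∉ k l q∈ p≤q with leqᵇ⁻ i j k l p≤q
    ... | i≤k , j≤l with ℕₚ.m≤n⇒m<n∨m≡n j≤l
    ...   | inj₁ j<l = ⊥-elim (true≢false (trans (sym (downClosed (k , l) (i , suc j) q∈ right∈T (leqᵇ⁺ i≤k j<l))) right∉))
      where
      t = InT-of i j p∈
      right∈T = inTᵇ⁺ (record { 1≤i = InT.1≤i t ; i≤a = InT.i≤a t ; i≤j = ℕₚ.m≤n⇒m≤1+n (InT.i≤j t)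
                             ; j≤n∸i = ℕₚ.≤-trans j<l (ℕₚ.≤-trans (InT.j≤n∸i (InT-of k l q∈)) (ℕₚ.∸-monoʳ-≤ n i≤k)) })
    ...   | inj₂ refl with ℕₚ.m≤n⇒m<n∨m≡n i≤k
    ...     | inj₂ refl = refl
    ...     | inj₁ i<k = ⊥-elim (true≢false (trans (sym (downClosed (k , j) (suc i , j) q∈ up∈T (leqᵇ⁺ i<k (ℕₚ.≤-refl {j})))) up∉))
      where
      t′ = InT-of k j q∈
      up∈T = inTᵇ⁺ (record { 1≤i = s≤s z≤n ; i≤a = ℕₚ.≤-trans i<k (InT.i≤a t′) ; i≤j = ℕₚ.≤-trans i<k (InT.i≤j t′)
                          ; j≤n∸i = ℕₚ.≤-trans (InT.j≤n∸i t′) (ℕₚ.∸-monoʳ-≤ n i<k) })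

    isMaximalᵇ : Elem → Bool
    isMaximalᵇ p = all (λ q → not (ltᵇ p q)) I

    isMaximalᵇ≡ : ∀ i j → memᵇ (i , j) I ≡ true →
      isMaximalᵇ (i , j) ≡ (not (memᵇ (suc i , j) I) ∧ not (memᵇ (i , suc j) I))
    isMaximalᵇ≡ i j p∈ = ≡true⇔≡true⇒≡
      (λ max → ∧≡true⁺ (cong not (absent (suc i , j) (ltᵇ-nextRow i j) max)) (cong not (absent (i , suc j) (ltᵇ-nextColumn i j) max)))
      (λ covers∉ → all≡true⁺ _ I (not-below (not≡true⇒≡false (∧≡true⁻ˡ covers∉)) (not≡true⇒≡false (∧≡true⁻ʳ {not (memᵇ (suc i , j) I)} covers∉))))
      where
      absent : ∀ q → ltᵇ (i , j) q ≡ true → isMaximalᵇ (i , j) ≡ true → memᵇ q I ≡ false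
      absent q p<q max = ¬-not (λ q∈ → true≢false (trans (sym p<q) (not≡true⇒≡false (all≡true⁻ _ I max q q∈))))
      not-below : memᵇ (suc i , j) I ≡ false → memᵇ (i , suc j) I ≡ false → ∀ q → memᵇ q I ≡ true → not (ltᵇ (i , j) q) ≡ true
      not-below up∉ right∉ (k , l) q∈ = compare (leqᵇ (i , j) (k , l)) refl
        where
        compare : ∀ t → leqᵇ (i , j) (k , l) ≡ t → not (ltᵇ (i , j) (k , l)) ≡ true
        compare false p≰q = cong (λ x → not (x ∧ not (eqᵇ (i , j) (k , l)))) p≰q
        compare true p≤q = cong not (trans (cong (ltᵇ (i , j)) (nothingAbove i j p∈ up∉ right∉ k l q∈ p≤q)) (ltᵇ-irrefl (i , j)))

    T⁻ᵇ : List Elem → Bool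
    T⁻ᵇ A = all (λ p → memᵇ p I) A ∧ isIdealᵇ a b (removeAll A I)

    T⁺ᵇ : List Elem → Bool
    T⁺ᵇ A = all (λ p → not (memᵇ p I)) A ∧ isIdealᵇ a b (A ++ I)

    removal-isIdeal : ∀ A → (∀ p′ q → memᵇ p′ (removeAll A I) ≡ true → inTᵇ a b q ≡ true → leqᵇ q p′ ≡ true → memᵇ q A ≡ false) →
      isIdealᵇ a b (removeAll A I) ≡ true
    removal-isIdeal A keeps-below = isIdealᵇ⁺ (removeAll A I)
      (λ p p∈ → ⊆T p (∧≡true⁻ˡ (trans (sym (memᵇ-removeAll A I p)) p∈)))
      (λ p q p∈ q∈T q≤p → trans (memᵇ-removeAll A I q)
        (∧≡true⁺ (downClosed p q (∧≡true⁻ˡ (trans (sym (memᵇ-removeAll A I p)) p∈)) q∈T q≤p) (cong not (keeps-below p q p∈ q∈T q≤p))))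

    T⁻ᵇ-single : ∀ i j → T⁻ᵇ ((i , j) ∷ []) ≡ (memᵇ (i , j) I ∧ not (memᵇ (suc i , j) I) ∧ not (memᵇ (i , suc j) I))
    T⁻ᵇ-single i j = ≡true⇔≡true⇒≡
      (λ T⁻ → ∧≡true⁺ (p∈I T⁻) (∧≡true⁺ (cong not (cover∉ T⁻ (suc i , j) (ltᵇ-nextRow i j)))
                                          (cong not (cover∉ T⁻ (i , suc j) (ltᵇ-nextColumn i j)))))
      (λ maximal → ∧≡true⁺ (∧≡true⁺ {memᵇ p I} (∧≡true⁻ˡ maximal) refl) (removal-isIdeal A (only-p-removed maximal)))
      where
      p = (i , j)
      A = p ∷ []
      p∈I : T⁻ᵇ A ≡ true → memᵇ p I ≡ true
      p∈I T⁻ = ∧≡true⁻ˡ (∧≡true⁻ˡ T⁻)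
      p∉R : memᵇ p (removeAll A I) ≡ false
      p∉R = trans (memᵇ-removeAll A I p) (trans (cong (λ e → memᵇ p I ∧ not (e ∨ false)) (eqᵇ-refl p)) (∧-zeroʳ (memᵇ p I)))
      cover∉ : T⁻ᵇ A ≡ true → ∀ q → ltᵇ p q ≡ true → memᵇ q I ≡ false
      cover∉ T⁻ q p<q = ¬-not λ q∈I → true≢false (trans (sym (p∈R q∈I)) p∉R)
        where
        q∈R : memᵇ q I ≡ true → memᵇ q (removeAll A I) ≡ true
        q∈R q∈I = trans (memᵇ-removeAll A I q)
          (∧≡true⁺ q∈I (cong not (cong (_∨ false) (≢⇒eqᵇ≡false q p (λ { refl → true≢false (trans (sym p<q) (ltᵇ-irrefl q)) })))))
        p∈R : memᵇ q I ≡ true → memᵇ p (removeAll A I) ≡ true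
        p∈R q∈I = isIdealᵇ⇒downClosed (removeAll A I) (∧≡true⁻ʳ {all (λ p → memᵇ p I) A} T⁻) q p (q∈R q∈I)
                    (⊆T p (p∈I T⁻)) (ltᵇ⇒leqᵇ p q p<q)
      only-p-removed : (memᵇ p I ∧ not (memᵇ (suc i , j) I) ∧ not (memᵇ (i , suc j) I)) ≡ true →
        ∀ p′ q → memᵇ p′ (removeAll A I) ≡ true → inTᵇ a b q ≡ true → leqᵇ q p′ ≡ true → memᵇ q A ≡ false
      only-p-removed maximal (k , l) q p′∈R _ q≤p′ = ¬-not same-as-p
        where
        covers∉ = ∧≡true⁻ʳ {memᵇ p I} maximal
        same-as-p : memᵇ q A ≢ true
        same-as-p q∈A with memᵇ-∷⁻ q p [] q∈A
        ... | inj₂ ()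
        ... | inj₁ refl with nothingAbove i j (∧≡true⁻ˡ maximal) (not≡true⇒≡false (∧≡true⁻ˡ covers∉))
                               (not≡true⇒≡false (∧≡true⁻ʳ {not (memᵇ (suc i , j) I)} covers∉))
                               k l (∧≡true⁻ˡ (trans (sym (memᵇ-removeAll A I (k , l))) p′∈R)) q≤p′
        ...   | refl = true≢false (trans (sym p′∈R) p∉R)

    addableToᵇ : ℕ → ℕ → Bool
    addableToᵇ i j = not (memᵇ (suc i , suc j) I) ∧ ((i ≡ᵇ 0) ∨ memᵇ (i , suc j) I) ∧ ((j ≡ᵇ i) ∨ memᵇ (suc i , j) I)

    upper∈T : ∀ {i j} → InT (suc i) (suc j) → i ≢ 0 → inTᵇ a b (i , suc j) ≡ true
    upper∈T {i} t i≢0 = inTᵇ⁺ (record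
      { 1≤i = ℕₚ.n≢0⇒n>0 i≢0 ; i≤a = ℕₚ.<⇒≤ (InT.i≤a t) ; i≤j = ℕₚ.m≤n⇒m≤1+n (ℕₚ.≤-pred (InT.i≤j t))
      ; j≤n∸i = ℕₚ.≤-trans (InT.j≤n∸i t) (ℕₚ.∸-monoʳ-≤ n (ℕₚ.n≤1+n i)) })

    left∈T : ∀ {i j} → InT (suc i) (suc j) → j ≢ i → inTᵇ a b (suc i , j) ≡ true
    left∈T {i} {j} t j≢i = inTᵇ⁺ (record
      { 1≤i = s≤s z≤n ; i≤a = InT.i≤a t ; i≤j = ℕₚ.≤∧≢⇒< (ℕₚ.≤-pred (InT.i≤j t)) (j≢i ∘ sym)
      ; j≤n∸i = ℕₚ.≤-trans (ℕₚ.n≤1+n j) (InT.j≤n∸i t) })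

    T⁺ᵇ⇒addableTo : ∀ i j → inTᵇ a b (suc i , suc j) ≡ true → T⁺ᵇ ((suc i , suc j) ∷ []) ≡ true → addableToᵇ i j ≡ true
    T⁺ᵇ⇒addableTo i j p∈T T⁺ = ∧≡true⁺ {not (memᵇ p I)} (∧≡true⁻ˡ (∧≡true⁻ˡ {not (memᵇ p I) ∧ true} T⁺)) (∧≡true⁺ upper-cover left-cover)
      where
      p = (suc i , suc j)
      added-ideal = ∧≡true⁻ʳ {not (memᵇ p I) ∧ true} T⁺
      lowerCover∈ : ∀ q → inTᵇ a b q ≡ true → leqᵇ q p ≡ true → q ≢ p → memᵇ q I ≡ true
      lowerCover∈ q q∈T q≤p q≢p with memᵇ-∷⁻ q p I (isIdealᵇ⇒downClosed (p ∷ I) added-ideal p q (memᵇ-here p I) q∈T q≤p)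
      ... | inj₁ q≡p = ⊥-elim (q≢p q≡p)
      ... | inj₂ q∈I = q∈I
      upper-cover : ((i ≡ᵇ 0) ∨ memᵇ (i , suc j) I) ≡ true
      upper-cover with i ≡ᵇ 0 in i≟0
      ... | true = refl
      ... | false = lowerCover∈ (i , suc j) (upper∈T (inTᵇ⁻ (suc i) (suc j) p∈T) (λ { refl → true≢false i≟0 }))
                      (leqᵇ⁺ (ℕₚ.n≤1+n i) (ℕₚ.≤-refl {suc j})) (λ q≡p → ℕₚ.<-irrefl (cong proj₁ q≡p) (ℕₚ.n<1+n i))
      left-cover : ((j ≡ᵇ i) ∨ memᵇ (suc i , j) I) ≡ true
      left-cover with j ≡ᵇ i in j≟i
      ... | true = refl
      ... | false = lowerCover∈ (suc i , j) (left∈T (inTᵇ⁻ (suc i) (suc j) p∈T) (λ j≡i → true≢false (trans (sym (≡⇒≡ᵇ≡true j≡i)) j≟i)))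
                      (leqᵇ⁺ (ℕₚ.≤-refl {suc i}) (ℕₚ.n≤1+n j)) (λ q≡p → ℕₚ.<-irrefl (cong proj₂ q≡p) (ℕₚ.n<1+n j))

    addableTo⇒T⁺ᵇ : ∀ i j → inTᵇ a b (suc i , suc j) ≡ true → addableToᵇ i j ≡ true → T⁺ᵇ ((suc i , suc j) ∷ []) ≡ true
    addableTo⇒T⁺ᵇ i j p∈T addable = ∧≡true⁺ (∧≡true⁺ {not (memᵇ p I)} (∧≡true⁻ˡ addable) refl) (isIdealᵇ⁺ (p ∷ I) sound closed)
      where
      p = (suc i , suc j)
      covers = ∧≡true⁻ʳ {not (memᵇ p I)} addable
      upper-cover = ∧≡true⁻ˡ covers
      left-cover = ∧≡true⁻ʳ {(i ≡ᵇ 0) ∨ memᵇ (i , suc j) I} covers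
      sound : ∀ q → memᵇ q (p ∷ I) ≡ true → inTᵇ a b q ≡ true
      sound q q∈ with memᵇ-∷⁻ q p I q∈
      ... | inj₁ refl = p∈T
      ... | inj₂ q∈I = ⊆T q q∈I
      below-p : ∀ k l → inTᵇ a b (k , l) ≡ true → leqᵇ (k , l) p ≡ true → memᵇ (k , l) (p ∷ I) ≡ true
      below-p k l q∈T q≤p with leqᵇ⁻ k l (suc i) (suc j) q≤p
      ... | k≤1+i , l≤1+j with ℕₚ.m≤n⇒m<n∨m≡n k≤1+i
      ...   | inj₁ k<1+i = memᵇ-there (k , l) p I (downClosed (i , suc j) (k , l)
                             (∨≡true-resolveˡ upper-cover (≢⇒≡ᵇ≡false i≢0)) q∈T (leqᵇ⁺ (ℕₚ.≤-pred k<1+i) l≤1+j))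
        where
        i≢0 : i ≢ 0
        i≢0 refl = ℕₚ.<-irrefl refl (ℕₚ.<-≤-trans k<1+i (InT.1≤i (inTᵇ⁻ k l q∈T)))
      ...   | inj₂ refl with ℕₚ.m≤n⇒m<n∨m≡n l≤1+j
      ...     | inj₂ refl = memᵇ-here p I
      ...     | inj₁ l<1+j = memᵇ-there (k , l) p I (downClosed (suc i , j) (k , l)
                               (∨≡true-resolveˡ left-cover (≢⇒≡ᵇ≡false j≢i)) q∈T (leqᵇ⁺ (ℕₚ.≤-refl {suc i}) (ℕₚ.≤-pred l<1+j)))
        where
        j≢i : j ≢ i
        j≢i refl = ℕₚ.<-irrefl refl (ℕₚ.<-≤-trans l<1+j (InT.i≤j (inTᵇ⁻ (suc j) l q∈T)))
      closed : ∀ p′ q → memᵇ p′ (p ∷ I) ≡ true → inTᵇ a b q ≡ true → leqᵇ q p′ ≡ true → memᵇ q (p ∷ I) ≡ true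
      closed p′ (k , l) p′∈ q∈T q≤p′ with memᵇ-∷⁻ p′ p I p′∈
      ... | inj₁ refl = below-p k l q∈T q≤p′
      ... | inj₂ p′∈I = memᵇ-there (k , l) p I (downClosed p′ (k , l) p′∈I q∈T q≤p′)

    T⁺ᵇ-single : ∀ i j → inTᵇ a b (i , j) ≡ true →
      T⁺ᵇ ((i , j) ∷ []) ≡ (not (memᵇ (i , j) I) ∧ ((i ≡ᵇ 1) ∨ memᵇ (i ∸ 1 , j) I) ∧ ((j ≡ᵇ i) ∨ memᵇ (i , j ∸ 1) I))
    T⁺ᵇ-single zero j p∈T with InT.1≤i (inTᵇ⁻ 0 j p∈T)
    ... | ()
    T⁺ᵇ-single (suc i) zero p∈T with InT.i≤j (inTᵇ⁻ (suc i) 0 p∈T)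
    ... | ()
    T⁺ᵇ-single (suc i) (suc j) p∈T = ≡true⇔≡true⇒≡ (T⁺ᵇ⇒addableTo i j p∈T) (addableTo⇒T⁺ᵇ i j p∈T)

    rowEnd-top : ∀ i k l → InT k l → i ℕ.≤ k → n ∸ i ℕ.≤ l → (k , l) ≡ (i , n ∸ i)
    rowEnd-top i k l t i≤k n∸i≤l = cong₂ _,_ k≡i l≡n∸i
      where
      k≤n : k ℕ.≤ n
      k≤n = ℕₚ.≤-trans (InT.i≤a t) (ℕₚ.m≤m+n a b)
      n∸k≡n∸i : n ∸ k ≡ n ∸ i
      n∸k≡n∸i = ℕₚ.≤-antisym (ℕₚ.∸-monoʳ-≤ n i≤k) (ℕₚ.≤-trans n∸i≤l (InT.j≤n∸i t))
      k≡i : k ≡ i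
      k≡i = ℕₚ.∸-cancelˡ-≡ k≤n (ℕₚ.≤-trans i≤k k≤n) n∸k≡n∸i
      l≡n∸i : l ≡ n ∸ i
      l≡n∸i = ℕₚ.≤-antisym (ℕₚ.≤-trans (InT.j≤n∸i t) (ℕₚ.≤-reflexive n∸k≡n∸i)) n∸i≤l

    T⁻ᵇ-rowEnds : ∀ i → T⁻ᵇ ((i , n ∸ i) ∷ (i ℕ.+ 1 , n ∸ (i ℕ.+ 1)) ∷ []) ≡
                         (memᵇ (i , n ∸ i) I ∧ memᵇ (i ℕ.+ 1 , n ∸ (i ℕ.+ 1)) I)
    T⁻ᵇ-rowEnds i = ≡true⇔≡true⇒≡
      (λ T⁻ → let both∈ = ∧≡true⁻ˡ {m₁ ∧ m₂ ∧ true} T⁻ in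
              ∧≡true⁺ {m₁} (∧≡true⁻ˡ {m₁} both∈) (∧≡true⁻ˡ {m₂} (∧≡true⁻ʳ {m₁} both∈)))
      (λ both∈ → ∧≡true⁺ {m₁ ∧ m₂ ∧ true} (∧≡true⁺ {m₁} (∧≡true⁻ˡ {m₁} both∈) (∧≡true⁺ {m₂} (∧≡true⁻ʳ {m₁} both∈) refl))
                         (removal-isIdeal A only-A-removed))
      where
      end₁ = (i , n ∸ i)
      end₂ = (i ℕ.+ 1 , n ∸ (i ℕ.+ 1))
      A = end₁ ∷ end₂ ∷ []
      m₁ = memᵇ end₁ I
      m₂ = memᵇ end₂ I
      only-A-removed : ∀ p′ q → memᵇ p′ (removeAll A I) ≡ true → inTᵇ a b q ≡ true → leqᵇ q p′ ≡ true → memᵇ q A ≡ false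
      only-A-removed (k , l) q p′∈R _ q≤p′ = memᵇ-false q A distinct
        where
        p′∈I = ∧≡true⁻ˡ (trans (sym (memᵇ-removeAll A I (k , l))) p′∈R)
        p′∉A : memᵇ (k , l) A ≡ false
        p′∉A = not≡true⇒≡false (∧≡true⁻ʳ {memᵇ (k , l) I} (trans (sym (memᵇ-removeAll A I (k , l))) p′∈R))
        rowEnd≰p′ : ∀ i′ → memᵇ (i′ , n ∸ i′) A ≡ true → leqᵇ (i′ , n ∸ i′) (k , l) ≡ true → ⊥
        rowEnd≰p′ i′ end∈A end≤p′ with leqᵇ⁻ i′ (n ∸ i′) k l end≤p′
        ... | i′≤k , n∸i′≤l = true≢false (trans (sym (subst (λ x → memᵇ x A ≡ true) (sym (rowEnd-top i′ k l (InT-of k l p′∈I) i′≤k n∸i′≤l)) end∈A)) p′∉A)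
        distinct : ∀ q′ → memᵇ q′ A ≡ true → q ≢ q′
        distinct q′ q′∈A refl with memᵇ-∷⁻ q end₁ (end₂ ∷ []) q′∈A
        ... | inj₁ refl = rowEnd≰p′ i q′∈A q≤p′
        ... | inj₂ q∈rest with memᵇ-∷⁻ q end₂ [] q∈rest
        ...   | inj₁ refl = rowEnd≰p′ (i ℕ.+ 1) q′∈A q≤p′
        ...   | inj₂ ()

    rowSegment : ∀ i → Σ[ c ∈ ℕ ] (c ℕ.≤ len i) × (∀ j → memᵇ (i , j) I ≡ ((i ≤ᵇ j) ∧ (j <ᵇ i ℕ.+ c)))
    rowSegment i = downClosed⇒initialSegment (λ j → memᵇ (i , j) I) i (len i) inRow leftClosed
      where
      inRow : ∀ j → memᵇ (i , j) I ≡ true → (i ℕ.≤ j) × (j ℕ.< i ℕ.+ len i)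
      inRow j p∈ = InT.i≤j (InT-of i j p∈) , InT⇒inRow (InT-of i j p∈)
      leftClosed : ∀ j j′ → memᵇ (i , j) I ≡ true → i ℕ.≤ j′ → j′ ℕ.≤ j → memᵇ (i , j′) I ≡ true
      leftClosed j j′ p∈ i≤j′ j′≤j = downClosed (i , j) (i , j′) p∈
        (inTᵇ⁺ (record { 1≤i = InT.1≤i t ; i≤a = InT.i≤a t ; i≤j = i≤j′ ; j≤n∸i = ℕₚ.≤-trans j′≤j (InT.j≤n∸i t) }))
        (leqᵇ⁺ (ℕₚ.≤-refl {i}) j′≤j)
        where t = InT-of i j p∈

    rowLength : ℕ → ℕ
    rowLength i = proj₁ (rowSegment i)

    open Profile a b rowLength using (filledᵇ; filled-intro; filled⇒<)

    memᵇ≡filledᵇ : ∀ i j → memᵇ (i , j) I ≡ filledᵇ i j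
    memᵇ≡filledᵇ i = proj₂ (proj₂ (rowSegment i))

    rowLength≤len : ∀ i → rowLength i ℕ.≤ len i
    rowLength≤len i = proj₁ (proj₂ (rowSegment i))

    rowLength-vanishes : ∀ i → a ℕ.< i → rowLength i ≡ 0
    rowLength-vanishes i a<i with rowLength i in len≡
    ... | zero = refl
    ... | suc c = ⊥-elim (ℕₚ.<-irrefl refl (ℕₚ.<-≤-trans a<i (InT.i≤a (InT-of i i diagonal∈))))
      where
      diagonal∈ : memᵇ (i , i) I ≡ true
      diagonal∈ = trans (memᵇ≡filledᵇ i i) (filled-intro ℕₚ.≤-refl (subst (λ m → i ℕ.< i ℕ.+ m) (sym len≡) (ℕₚ.m<m+n i (s≤s z≤n))))

    rowLength-decreasing : ∀ i → 1 ℕ.≤ i → rowLength (suc i) ℕ.≤ rowLength i ∸ 1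
    rowLength-decreasing i 1≤i with rowLength (suc i) in len≡
    ... | zero = z≤n
    ... | suc d = ℕₚ.∸-monoˡ-≤ 1 (ℕₚ.+-cancelˡ-≤ i (suc (suc d)) (rowLength i)
                    (ℕₚ.≤-trans (ℕₚ.≤-reflexive (trans (ℕₚ.+-suc i (suc d)) (cong suc (ℕₚ.+-suc i d)))) below-end))
      where
      j = suc i ℕ.+ d
      above∈ : memᵇ (suc i , j) I ≡ true
      above∈ = trans (memᵇ≡filledᵇ (suc i) j)
        (filled-intro (ℕₚ.m≤m+n (suc i) d) (subst (λ m → j ℕ.< suc i ℕ.+ m) (sym len≡) (ℕₚ.+-monoʳ-< (suc i) (ℕₚ.n<1+n d))))
      t = InT-of (suc i) j above∈
      below∈ : memᵇ (i , j) I ≡ true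
      below∈ = downClosed (suc i , j) (i , j) above∈
        (inTᵇ⁺ (record { 1≤i = 1≤i ; i≤a = ℕₚ.≤-trans (ℕₚ.n≤1+n i) (InT.i≤a t) ; i≤j = ℕₚ.≤-trans (ℕₚ.n≤1+n i) (InT.i≤j t)
                       ; j≤n∸i = ℕₚ.≤-trans (InT.j≤n∸i t) (ℕₚ.∸-monoʳ-≤ n (ℕₚ.n≤1+n i)) }))
        (leqᵇ⁺ (ℕₚ.n≤1+n i) (ℕₚ.≤-refl {j}))
      below-end : j ℕ.< i ℕ.+ rowLength i
      below-end = filled⇒< i j (trans (sym (memᵇ≡filledᵇ i j)) below∈)


-- Passage to ℚ and expectations

ι : ℤ → ℚ
ι z = z / 1

toℚᵘ-ι : ∀ z → toℚᵘ (ι z) ℚᵘ.≃ mkℚᵘ z 0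
toℚᵘ-ι z = ℚₚ.toℚᵘ-fromℚᵘ (mkℚᵘ z 0)

ι-+ : ∀ x y → ι (x ℤ.+ y) ≡ ι x ℚ.+ ι y
ι-+ x y = ℚₚ.toℚᵘ-injective (ℚᵘₚ.≃-trans (toℚᵘ-ι (x ℤ.+ y)) (ℚᵘₚ.≃-trans (*≡* (over-one x y))
            (ℚᵘₚ.≃-sym (ℚᵘₚ.≃-trans (ℚₚ.toℚᵘ-homo-+ (ι x) (ι y)) (ℚᵘₚ.+-cong (toℚᵘ-ι x) (toℚᵘ-ι y))))))
  where
  over-one : ∀ x y → (x ℤ.+ y) ℤ.* 1ℤ ≡ (x ℤ.* 1ℤ ℤ.+ y ℤ.* 1ℤ) ℤ.* 1ℤ
  over-one = solve-∀

ι-* : ∀ x y → ι (x ℤ.* y) ≡ ι x ℚ.* ι y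
ι-* x y = ℚₚ.toℚᵘ-injective (ℚᵘₚ.≃-trans (toℚᵘ-ι (x ℤ.* y))
            (ℚᵘₚ.≃-sym (ℚᵘₚ.≃-trans (ℚₚ.toℚᵘ-homo-* (ι x) (ι y)) (ℚᵘₚ.*-cong (toℚᵘ-ι x) (toℚᵘ-ι y)))))

ι-neg : ∀ x → ι (ℤ.- x) ≡ ℚ.- ι x
ι-neg x = ℚₚ.toℚᵘ-injective (ℚᵘₚ.≃-trans (toℚᵘ-ι (ℤ.- x)) (ℚᵘₚ.≃-sym (ℚᵘₚ.≃-trans (ℚₚ.toℚᵘ-homo‿- (ι x)) (ℚᵘₚ.-‿cong (toℚᵘ-ι x)))))

ι-- : ∀ x y → ι (x ℤ.- y) ≡ ι x ℚ.- ι y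
ι-- x y = trans (ι-+ x (ℤ.- y)) (cong (ι x ℚ.+_) (ι-neg y))

ι-sum : ∀ {A : Set} (f : A → ℤ) xs → sumℚ (map (ι ∘ f) xs) ≡ ι (sumℤ (map f xs))
ι-sum f [] = refl
ι-sum f (x ∷ xs) = trans (cong (ι (f x) ℚ.+_) (ι-sum f xs)) (sym (ι-+ (f x) (sumℤ (map f xs))))

boolℚ≡ι𝟙 : ∀ x → boolℚ x ≡ ι (𝟙 x)
boolℚ≡ι𝟙 true = refl
boolℚ≡ι𝟙 false = refl

frac≡ι* : ∀ z m → frac z (suc m) ≡ ι z ℚ.* frac (+ 1) (suc m)
frac≡ι* z m = ℚₚ.toℚᵘ-injective (ℚᵘₚ.≃-trans (ℚₚ.toℚᵘ-fromℚᵘ (mkℚᵘ z m)) (ℚᵘₚ.≃-trans (*≡* (cross z m))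
  (ℚᵘₚ.≃-sym (ℚᵘₚ.≃-trans (ℚₚ.toℚᵘ-homo-* (ι z) (+ 1 / suc m)) (ℚᵘₚ.*-cong (toℚᵘ-ι z) (ℚₚ.toℚᵘ-fromℚᵘ (mkℚᵘ (+ 1) m)))))))
  where
  cross : ∀ z m → z ℤ.* + suc (m ℕ.+ 0) ≡ (z ℤ.* + 1) ℤ.* + suc m
  cross z m rewrite ℕₚ.+-identityʳ m = sym (cong (ℤ._* + suc m) (ℤₚ.*-identityʳ z))

ι*frac-inverse : ∀ m → ι (+ suc m) ℚ.* frac (+ 1) (suc m) ≡ 1ℚ
ι*frac-inverse m = ℚₚ.toℚᵘ-injective (ℚᵘₚ.≃-trans (ℚₚ.toℚᵘ-homo-* (ι (+ suc m)) (+ 1 / suc m))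
  (ℚᵘₚ.≃-trans (ℚᵘₚ.*-cong (toℚᵘ-ι (+ suc m)) (ℚₚ.toℚᵘ-fromℚᵘ (mkℚᵘ (+ 1) m))) (*≡* (cross m))))
  where
  cross : ∀ m → (+ suc m ℤ.* + 1) ℤ.* + 1 ≡ + 1 ℤ.* + suc (m ℕ.+ 0)
  cross m rewrite ℕₚ.+-identityʳ m = unit (+ suc m)
    where
    unit : ∀ X → (X ℤ.* 1ℤ) ℤ.* 1ℤ ≡ 1ℤ ℤ.* X
    unit = solve-∀

module Expectation {A : Set} (μ : A → ℚ) where

  E : List A → (A → ℚ) → ℚ
  E X f = sumℚ (map (λ x → μ x ℚ.* f x) X)

  E-cong : ∀ {P : A → Set} X f g → (∀ x → P x → f x ≡ g x) → All P X → E X f ≡ E X g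
  E-cong [] f g _ All.[] = refl
  E-cong (x ∷ X) f g f≗g (px All.∷ pX) = cong₂ (λ u v → μ x ℚ.* u ℚ.+ v) (f≗g x px) (E-cong X f g f≗g pX)

  E-affine : ∀ X K C U F G H → E X (λ x → K ℚ.+ C ℚ.* (F x ℚ.- G x) ℚ.- U ℚ.* H x)
                               ≡ K ℚ.* sumℚ (map μ X) ℚ.+ C ℚ.* (E X F ℚ.- E X G) ℚ.- U ℚ.* E X H
  E-affine [] K C U F G H = ℚ-solve 3 (λ K C U → con 0ℚ := K :* con 0ℚ :+ C :* (con 0ℚ :- con 0ℚ) :- U :* con 0ℚ) refl K C U
  E-affine (x ∷ X) K C U F G H rewrite E-affine X K C U F G H =
    ℚ-solve 11 (λ m K C U f g h s ef eg eh →
        m :* (K :+ C :* (f :- g) :- U :* h) :+ (K :* s :+ C :* (ef :- eg) :- U :* eh)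
        := K :* (m :+ s) :+ C :* ((m :* f :+ ef) :- (m :* g :+ eg)) :- U :* (m :* h :+ eh)) refl
      (μ x) K C U (F x) (G x) (H x) (sumℚ (map μ X)) (E X F) (E X G) (E X H)

  E-sum : ∀ {B : Set} X (L : List B) (c : B → ℚ) (F : B → A → ℚ) →
    E X (λ x → sumℚ (map (λ i → c i ℚ.* F i x) L)) ≡ sumℚ (map (λ i → c i ℚ.* E X (F i)) L)
  E-sum X [] c F = E-0 X
    where
    E-0 : ∀ X → E X (λ _ → 0ℚ) ≡ 0ℚ
    E-0 [] = refl
    E-0 (x ∷ X) rewrite E-0 X = ℚ-solve 1 (λ m → m :* con 0ℚ :+ con 0ℚ := con 0ℚ) refl (μ x)
  E-sum X (i ∷ L) c F = trans (split X) (cong (c i ℚ.* E X (F i) ℚ.+_) (E-sum X L c F))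
    where
    rest = λ x → sumℚ (map (λ i → c i ℚ.* F i x) L)
    split : ∀ X → E X (λ x → c i ℚ.* F i x ℚ.+ rest x) ≡ c i ℚ.* E X (F i) ℚ.+ E X rest
    split [] = ℚ-solve 1 (λ c → con 0ℚ := c :* con 0ℚ :+ con 0ℚ) refl (c i)
    split (x ∷ X) rewrite split X =
      ℚ-solve 6 (λ m ci f r e t → m :* (ci :* f :+ r) :+ (ci :* e :+ t) := ci :* (m :* f :+ e) :+ (m :* r :+ t)) refl
        (μ x) (c i) (F i x) (rest x) (E X (F i)) (E X rest)

sumℚ-vanishing : ∀ (L : List Elem) (c g : Elem → ℚ) → (∀ p → memᵇ p L ≡ true → g p ≡ 0ℚ) →
  sumℚ (map (λ p → c p ℚ.* g p) L) ≡ 0ℚ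
sumℚ-vanishing [] c g _ = refl
sumℚ-vanishing (q ∷ L) c g g≡0 rewrite g≡0 q (memᵇ-here q L) | sumℚ-vanishing L c g (λ p p∈ → g≡0 p (memᵇ-there p q L p∈)) =
  ℚ-solve 1 (λ x → x :* con 0ℚ :+ con 0ℚ := con 0ℚ) refl (c q)

sublists-⊆ : ∀ {A : Set} (xs : List A) → All (_⊆ xs) (sublists xs)
sublists-⊆ [] = Sublist.[] All.∷ All.[]
sublists-⊆ (x ∷ xs) = Allₚ.++⁺ (All.map (x ∷ʳ_) (sublists-⊆ xs)) (Allₚ.map⁺ (All.map (refl Sublist.∷_) (sublists-⊆ xs)))

ideals-wellFormed : ∀ a b → All (λ I → (isIdealᵇ a b I ≡ true) × (I ⊆ elems a b)) (ideals a b)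
ideals-wellFormed a b = All.zip (All.map T⇒≡true (Allₚ.all-filter (T? ∘ isIdealᵇ a b) (sublists (elems a b))) ,
                                 Allₚ.filter⁺ (T? ∘ isIdealᵇ a b) (sublists-⊆ (elems a b)))

range-bounds : ∀ lo k → All (λ i → (lo ℕ.≤ i) × (i ℕ.< lo ℕ.+ k)) (range lo k)
range-bounds lo k = Allₚ.map⁺ (Allₚ.applyUpTo⁺₁ (λ i → i) k (λ {i} i<k → ℕₚ.m≤m+n lo i , ℕₚ.+-monoʳ-< lo i<k))

all-memᵇ : ∀ L → All (λ p → memᵇ p L ≡ true) L
all-memᵇ [] = All.[]
all-memᵇ (x ∷ L) = memᵇ-here x L All.∷ All.map (λ {p} → memᵇ-there p x L) (all-memᵇ L)


-- The pointwise identity and the theorem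

module Statistics (a b : ℕ) where

  open Rows a b using (w)

  diagonalStat : List Elem → ℚ
  diagonalStat I = sumℚ (map (λ i → natℚ (a ∸ i) ℚ.* T⁺ a b ((i , i) ∷ []) I) (range 1 a))

  rowEndsStat : List Elem → ℚ
  rowEndsStat I = sumℚ (map (λ i → natℚ i ℚ.* T⁻ a b ((i , lam a b i) ∷ (i ℕ.+ 1 , lam a b (i ℕ.+ 1)) ∷ []) I) (range 1 (a ∸ 1)))

  toggleStat : List Elem → ℚ
  toggleStat I = sumℚ (map (λ p → ι (uncurry w p) ℚ.* Tog a b (p ∷ []) I) (elems a b))

  𝔼-toggleStat : ∀ μ → ToggleSymmetric a b μ → 𝔼 a b μ toggleStat ≡ 0ℚ
  𝔼-toggleStat μ symmetric = trans (E-sum (ideals a b) (elems a b) (ι ∘ uncurry w) (λ p → Tog a b (p ∷ [])))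
    (sumℚ-vanishing (elems a b) (ι ∘ uncurry w) (λ p → E (ideals a b) (Tog a b (p ∷ [])))
                    (λ p p∈ → symmetric p (Triangle.∈elems⇒inTᵇ a b p p∈)))
    where open Expectation μ

  𝔼-diagonalStat : ∀ μ → 𝔼 a b μ diagonalStat ≡ sumℚ (map (λ i → natℚ (a ∸ i) ℚ.* 𝔼 a b μ (T⁺ a b ((i , i) ∷ []))) (range 1 a))
  𝔼-diagonalStat μ = E-sum (ideals a b) (range 1 a) (λ i → natℚ (a ∸ i)) (λ i → T⁺ a b ((i , i) ∷ []))
    where open Expectation μ

  𝔼-rowEndsStat : ∀ μ → 𝔼 a b μ rowEndsStat ≡
    sumℚ (map (λ i → natℚ i ℚ.* 𝔼 a b μ (T⁻ a b ((i , lam a b i) ∷ (i ℕ.+ 1 , lam a b (i ℕ.+ 1)) ∷ []))) (range 1 (a ∸ 1)))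
  𝔼-rowEndsStat μ = E-sum (ideals a b) (range 1 (a ∸ 1)) natℚ (λ i → T⁻ a b ((i , lam a b i) ∷ (i ℕ.+ 1 , lam a b (i ℕ.+ 1)) ∷ []))
    where open Expectation μ

solve-for : ∀ D W X Y Z M U → M ℚ.* D ℚ.+ W ≡ X ℚ.+ Y ℚ.* Z → M ℚ.* U ≡ 1ℚ → D ≡ X ℚ.* U ℚ.+ (Y ℚ.* U) ℚ.* Z ℚ.- U ℚ.* W
solve-for D W X Y Z M U linear inverse = begin
  D                                  ≡⟨ ℚ-solve 1 (λ D → D := con 1ℚ :* D) refl D ⟩
  1ℚ ℚ.* D                           ≡⟨ cong (ℚ._* D) (sym inverse) ⟩
  (M ℚ.* U) ℚ.* D                    ≡⟨ ℚ-solve 4 (λ D W M U → (M :* U) :* D := U :* (M :* D :+ W) :- U :* W) refl D W M U ⟩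
  U ℚ.* (M ℚ.* D ℚ.+ W) ℚ.- U ℚ.* W  ≡⟨ cong (λ t → U ℚ.* t ℚ.- U ℚ.* W) linear ⟩
  U ℚ.* (X ℚ.+ Y ℚ.* Z) ℚ.- U ℚ.* W  ≡⟨ ℚ-solve 5 (λ W X Y Z U → U :* (X :+ Y :* Z) :- U :* W := X :* U :+ (Y :* U) :* Z :- U :* W) refl W X Y Z U ⟩
  X ℚ.* U ℚ.+ (Y ℚ.* U) ℚ.* Z ℚ.- U ℚ.* W ∎
  where open ≡-Reasoning

module Pointwise (a′ b : ℕ) (a≤b : suc a′ ℕ.≤ b) (I : List Elem) (I-ideal : isIdealᵇ (suc a′) b I ≡ true)
                 (I⊆T : I ⊆ elems (suc a′) b) where

  a = suc a′

  open Ideals a b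
  open Ideal I I-ideal
  open ValidProfile a b rowLength (s≤s z≤n) a≤b (λ i _ _ → rowLength≤len i) (rowLength-vanishes (suc a) ℕₚ.≤-refl)
                    rowLength-decreasing
  open Statistics a b
  open ≡-Reasoning

  maximalᵇ≡ : ∀ i j → (memᵇ (i , j) I ∧ not (memᵇ (suc i , j) I) ∧ not (memᵇ (i , suc j) I)) ≡ maximalᵇ i j
  maximalᵇ≡ i j = sym (maximalᵇ-eval i j (sym (memᵇ≡filledᵇ i j)) (sym (memᵇ≡filledᵇ (suc i) j)) (sym (memᵇ≡filledᵇ i (suc j))))

  addableᵇ≡ : ∀ i j → (not (memᵇ (i , j) I) ∧ ((i ≡ᵇ 1) ∨ memᵇ (i ∸ 1 , j) I) ∧ ((j ≡ᵇ i) ∨ memᵇ (i , j ∸ 1) I)) ≡ addableᵇ i j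
  addableᵇ≡ i j = sym (addableᵇ-eval i j (sym (memᵇ≡filledᵇ i j))
    (cong ((i ≡ᵇ 1) ∨_) (sym (memᵇ≡filledᵇ (i ∸ 1) j))) (cong ((j ≡ᵇ i) ∨_) (sym (memᵇ≡filledᵇ i (j ∸ 1)))))

  ddeg≡ : + ddeg I ≡ sumRange maximalCount 1 a
  ddeg≡ = begin
    + ddeg I                                                       ≡⟨ count≡sumℤ isMaximalᵇ I ⟩
    sumℤ (map (𝟙 ∘ isMaximalᵇ) I)                                   ≡⟨ sumℤ-⊆ I⊆T uniqueᵇ-elems isMaximalᵇ ⟩
    sumℤ (map (λ p → 𝟙 (memᵇ p I ∧ isMaximalᵇ p)) (elems a b))      ≡⟨ sumℤ-elems _ ⟩
    sumRange (λ i → sumRange (λ j → 𝟙 (memᵇ (i , j) I ∧ isMaximalᵇ (i , j))) i (len i)) 1 a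
      ≡⟨ sumRange-cong _ _ 1 a (λ i _ _ → sumRange-cong _ _ i (len i) (λ j _ _ → cong 𝟙 (maximalCell i j))) ⟩
    sumRange maximalCount 1 a                                       ∎
    where
    maximalCell : ∀ i j → (memᵇ (i , j) I ∧ isMaximalᵇ (i , j)) ≡ maximalᵇ i j
    maximalCell i j with memᵇ (i , j) I in p∈
    ... | true = trans (isMaximalᵇ≡ i j p∈) (trans (cong (λ m → m ∧ not (memᵇ (suc i , j) I) ∧ not (memᵇ (i , suc j) I)) (sym p∈)) (maximalᵇ≡ i j))
    ... | false = trans (cong (λ m → m ∧ not (memᵇ (suc i , j) I) ∧ not (memᵇ (i , suc j) I)) (sym p∈)) (maximalᵇ≡ i j)

  toggleStat≡ : toggleStat I ≡ ι (sumRange toggleWeight 1 a)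
  toggleStat≡ = begin
    toggleStat I                   ≡⟨ cong sumℚ (map-cong-local (All.map (λ {p} p∈ → cell p (∈elems⇒inTᵇ p p∈)) (all-memᵇ (elems a b)))) ⟩
    sumℚ (map (ι ∘ g) (elems a b)) ≡⟨ ι-sum g (elems a b) ⟩
    ι (sumℤ (map g (elems a b)))   ≡⟨ cong ι (sumℤ-elems g) ⟩
    ι (sumRange toggleWeight 1 a)  ∎
    where
    g : Elem → ℤ
    g (i , j) = w i j ℤ.* (𝟙 (addableᵇ i j) ℤ.- 𝟙 (maximalᵇ i j))
    cell : ∀ p → inTᵇ a b p ≡ true → ι (uncurry w p) ℚ.* Tog a b (p ∷ []) I ≡ ι (g p)
    cell (i , j) p∈T = begin
      ι (w i j) ℚ.* (boolℚ (T⁺ᵇ ((i , j) ∷ [])) ℚ.- boolℚ (T⁻ᵇ ((i , j) ∷ [])))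
        ≡⟨ cong₂ (λ x y → ι (w i j) ℚ.* (x ℚ.- y))
                 (trans (boolℚ≡ι𝟙 (T⁺ᵇ ((i , j) ∷ []))) (cong (ι ∘ 𝟙) (trans (T⁺ᵇ-single i j p∈T) (addableᵇ≡ i j))))
                 (trans (boolℚ≡ι𝟙 (T⁻ᵇ ((i , j) ∷ []))) (cong (ι ∘ 𝟙) (trans (T⁻ᵇ-single i j) (maximalᵇ≡ i j)))) ⟩
      ι (w i j) ℚ.* (ι (𝟙 (addableᵇ i j)) ℚ.- ι (𝟙 (maximalᵇ i j)))
        ≡⟨ sym (trans (ι-* (w i j) _) (cong (ι (w i j) ℚ.*_) (ι-- (𝟙 (addableᵇ i j)) (𝟙 (maximalᵇ i j))))) ⟩
      ι (g (i , j)) ∎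

  diagonalStat≡ : diagonalStat I ≡ ι (sumRange diagonalTerm 1 a)
  diagonalStat≡ = begin
    diagonalStat I                       ≡⟨ cong sumℚ (map-cong-local (All.map (λ {i} (1≤i , i<1+a) → cell i 1≤i (ℕₚ.≤-pred i<1+a)) (range-bounds 1 a))) ⟩
    sumℚ (map (ι ∘ diagonalTerm) (range 1 a)) ≡⟨ ι-sum diagonalTerm (range 1 a) ⟩
    ι (sumℤ (map diagonalTerm (range 1 a)))   ≡⟨ cong ι (sumℤ-range diagonalTerm 1 a) ⟩
    ι (sumRange diagonalTerm 1 a)             ∎
    where
    diagonal∈T : ∀ i → 1 ℕ.≤ i → i ℕ.≤ a → inTᵇ a b (i , i) ≡ true
    diagonal∈T i 1≤i i≤a = inTᵇ⁺ (record { 1≤i = 1≤i ; i≤a = i≤a ; i≤j = ℕₚ.≤-refl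
                                        ; j≤n∸i = ℕₚ.m+n≤o⇒m≤o∸n i (ℕₚ.+-mono-≤ i≤a (ℕₚ.≤-trans i≤a a≤b)) })
    cell : ∀ i → 1 ℕ.≤ i → i ℕ.≤ a → natℚ (a ∸ i) ℚ.* T⁺ a b ((i , i) ∷ []) I ≡ ι (diagonalTerm i)
    cell i 1≤i i≤a = trans (cong (natℚ (a ∸ i) ℚ.*_) (trans (boolℚ≡ι𝟙 (T⁺ᵇ ((i , i) ∷ [])))
                             (cong (ι ∘ 𝟙) (trans (T⁺ᵇ-single i i (diagonal∈T i 1≤i i≤a)) (addableᵇ≡ i i)))))
                           (sym (ι-* (+ (a ∸ i)) (𝟙 (addableᵇ i i))))

  rowEndsStat≡ : rowEndsStat I ≡ ι (sumRange fullPairTerm 1 (a ∸ 1))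
  rowEndsStat≡ = begin
    rowEndsStat I                                   ≡⟨ cong sumℚ (map-cong cell (range 1 (a ∸ 1))) ⟩
    sumℚ (map (ι ∘ fullPairTerm) (range 1 (a ∸ 1))) ≡⟨ ι-sum fullPairTerm (range 1 (a ∸ 1)) ⟩
    ι (sumℤ (map fullPairTerm (range 1 (a ∸ 1))))   ≡⟨ cong ι (sumℤ-range fullPairTerm 1 (a ∸ 1)) ⟩
    ι (sumRange fullPairTerm 1 (a ∸ 1))             ∎
    where
    cell : ∀ i → natℚ i ℚ.* T⁻ a b ((i , lam a b i) ∷ (i ℕ.+ 1 , lam a b (i ℕ.+ 1)) ∷ []) I ≡ ι (fullPairTerm i)
    cell i = trans (cong (natℚ i ℚ.*_) (trans (boolℚ≡ι𝟙 (T⁻ᵇ ((i , n ∸ i) ∷ (i ℕ.+ 1 , n ∸ (i ℕ.+ 1)) ∷ []))) (cong (ι ∘ 𝟙) (trans (T⁻ᵇ-rowEnds i)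
                     (cong₂ _∧_ (memᵇ≡filledᵇ i (n ∸ i)) (memᵇ≡filledᵇ (i ℕ.+ 1) (n ∸ (i ℕ.+ 1))))))))
                   (sym (ι-* (+ i) _))

  ddeg-affine : natℚ (ddeg I) ≡ frac (+ (a ℕ.* b)) (a ℕ.+ b)
                                ℚ.+ frac (+ a ℤ.- + b) (a ℕ.+ b) ℚ.* (diagonalStat I ℚ.- rowEndsStat I)
                                ℚ.- frac (+ 1) (a ℕ.+ b) ℚ.* toggleStat I
  ddeg-affine =
    trans (solve-for (natℚ (ddeg I)) (toggleStat I) (ι (+ (a ℕ.* b))) (ι (+ a ℤ.- + b)) (diagonalStat I ℚ.- rowEndsStat I) (ι N) (frac (+ 1) (a ℕ.+ b)) linear (trans (cong (ℚ._* frac (+ 1) (a ℕ.+ b)) ι-N) (ι*frac-inverse (a′ ℕ.+ b))))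
          (cong₂ (λ K C → K ℚ.+ C ℚ.* (diagonalStat I ℚ.- rowEndsStat I) ℚ.- frac (+ 1) (a ℕ.+ b) ℚ.* toggleStat I)
                 (sym (frac≡ι* (+ (a ℕ.* b)) (a′ ℕ.+ b))) (sym (frac≡ι* (+ a ℤ.- + b) (a′ ℕ.+ b))))
    where
    ι-N : ι N ≡ ι (+ suc (a′ ℕ.+ b))
    ι-N = cong ι (sym (ℤₚ.pos-+ a b))
    ΣM = sumRange maximalCount 1 a
    ΣT = sumRange toggleWeight 1 a
    ΣD = sumRange diagonalTerm 1 a
    ΣF = sumRange fullPairTerm 1 (a ∸ 1)
    AB = + a ℤ.- + b
    linear : ι N ℚ.* natℚ (ddeg I) ℚ.+ toggleStat I ≡ ι (+ (a ℕ.* b)) ℚ.+ ι AB ℚ.* (diagonalStat I ℚ.- rowEndsStat I)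
    linear = begin
      ι N ℚ.* natℚ (ddeg I) ℚ.+ toggleStat I       ≡⟨ cong₂ (λ x y → ι N ℚ.* x ℚ.+ y) (cong ι ddeg≡) toggleStat≡ ⟩
      ι N ℚ.* ι ΣM ℚ.+ ι ΣT                         ≡⟨ sym (trans (ι-+ (N ℤ.* ΣM) ΣT) (cong (ℚ._+ ι ΣT) (ι-* N ΣM))) ⟩
      ι (N ℤ.* ΣM ℤ.+ ΣT)                           ≡⟨ cong ι profileIdentity ⟩
      ι (+ (a ℕ.* b) ℤ.+ AB ℤ.* (ΣD ℤ.- ΣF))        ≡⟨ trans (ι-+ (+ (a ℕ.* b)) (AB ℤ.* (ΣD ℤ.- ΣF))) (cong (ι (+ (a ℕ.* b)) ℚ.+_) (trans (ι-* AB (ΣD ℤ.- ΣF)) (cong (ι AB ℚ.*_) (ι-- ΣD ΣF)))) ⟩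
      ι (+ (a ℕ.* b)) ℚ.+ ι AB ℚ.* (ι ΣD ℚ.- ι ΣF) ≡⟨ cong₂ (λ x y → ι (+ (a ℕ.* b)) ℚ.+ ι AB ℚ.* (x ℚ.- y)) (sym diagonalStat≡) (sym rowEndsStat≡) ⟩
      ι (+ (a ℕ.* b)) ℚ.+ ι AB ℚ.* (diagonalStat I ℚ.- rowEndsStat I) ∎

lemma6p8 : (a b : ℕ) → 1 ≤ a → a ≤ b → (μ : List Elem → ℚ) → IsProbDist a b μ → ToggleSymmetric a b μ →
    𝔼 a b μ (λ I → natℚ (ddeg I))
      ≡ frac (+ (a * b)) (a + b)
        ℚ.+ frac ((+ a) ℤ.- (+ b)) (a + b)
          ℚ.* (sumℚ (map (λ i → natℚ (a ∸ i) ℚ.* 𝔼 a b μ (T⁺ a b ((i , i) ∷ []))) (range 1 a))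
               ℚ.- sumℚ (map (λ i → natℚ i ℚ.* 𝔼 a b μ (T⁻ a b ((i , lam a b i) ∷ (i + 1 , lam a b (i + 1)) ∷ []))) (range 1 (a ∸ 1))))
lemma6p8 (suc a′) b (s≤s z≤n) a≤b μ (_ , total) symmetric = begin
  E X (natℚ ∘ ddeg)
    ≡⟨ E-cong X _ _ (λ I (I-ideal , I⊆T) → Pointwise.ddeg-affine a′ b a≤b I I-ideal I⊆T) (ideals-wellFormed a b) ⟩
  E X (λ I → K ℚ.+ C ℚ.* (diagonalStat I ℚ.- rowEndsStat I) ℚ.- U ℚ.* toggleStat I)
    ≡⟨ E-affine X K C U diagonalStat rowEndsStat toggleStat ⟩
  K ℚ.* sumℚ (map μ X) ℚ.+ C ℚ.* (E X diagonalStat ℚ.- E X rowEndsStat) ℚ.- U ℚ.* E X toggleStat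
    ≡⟨ collapse K C U total (𝔼-diagonalStat μ) (𝔼-rowEndsStat μ) (𝔼-toggleStat μ symmetric) ⟩
  K ℚ.+ C ℚ.* (S₁ ℚ.- S₂) ∎
  where
  open ≡-Reasoning
  open Expectation μ
  a = suc a′
  open Statistics a b
  X = ideals a b
  K = frac (+ (a ℕ.* b)) (a ℕ.+ b)
  C = frac (+ a ℤ.- + b) (a ℕ.+ b)
  U = frac (+ 1) (a ℕ.+ b)
  S₁ = sumℚ (map (λ i → natℚ (a ∸ i) ℚ.* 𝔼 a b μ (T⁺ a b ((i , i) ∷ []))) (range 1 a))
  S₂ = sumℚ (map (λ i → natℚ i ℚ.* 𝔼 a b μ (T⁻ a b ((i , lam a b i) ∷ (i + 1 , lam a b (i + 1)) ∷ []))) (range 1 (a ∸ 1)))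
  collapse : ∀ k c u {t s₁ s₂ z S₁ S₂} → t ≡ 1ℚ → s₁ ≡ S₁ → s₂ ≡ S₂ → z ≡ 0ℚ →
    k ℚ.* t ℚ.+ c ℚ.* (s₁ ℚ.- s₂) ℚ.- u ℚ.* z ≡ k ℚ.+ c ℚ.* (S₁ ℚ.- S₂)
  collapse k c u {S₁ = S₁} {S₂} refl refl refl refl =
    ℚ-solve 5 (λ K C U s t → K :* con 1ℚ :+ C :* (s :- t) :- U :* con 0ℚ := K :+ C :* (s :- t)) refl k c u S₁ S₂
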